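{- Let $\mathcal L$ be a countable first-order language containing at least one constant symbol, and let $S$ be a set of order clauses of $\mathcal L$. For every $C\in\mathit{clo}^{\mathcal{BH}}(S)$ there exists $C^*\in\mathit{clo}^{\mathcal H}(S)$ such that $C$ is an instance of $C^*$.
   Context: Syntax. $\mathcal L$ is a first-order language with a set of truth constants $\overline{C}_{\mathcal L}=\{\bar c: c\in C_{\mathcal L}\}$, $\{0,1\}\subseteq C_{\mathcal L}\subseteq[0,1]$ countable. A quantified atom is $Qx\,p(t_0,\dots,t_n)$, $Q\in\{\forall,\exists\}$, with $x$ occurring in the atom and each $t_i$ either equal to $x$ or not containing $x$. An order literal is $\varepsilon_1\eqcirc\varepsilon_2$ or $\varepsilon_1\prec\varepsilon_2$ with $\varepsilon_i$ atoms, truth constants or quantified atoms ($\varepsilon_1\eqcirc\varepsilon_2$ identified with $\varepsilon_2\eqcirc\varepsilon_1$). An order clause is a finite set of order literals (written as a disjunction); $\square$ is the empty clause. $\mathit{atoms}(X),\mathit{qatoms}(X),\mathit{qatoms}^\forall(X),\mathit{qatoms}^\exists(X),\mathit{tcons}(X)$ denote the atoms, quantified atoms, universal/existential quantified atoms and truth constants occurring in $X$; $\mathit{Vrnt}(X)$ the variants of clauses of $X$. Substitutions act on quantified atoms only on free variables without capturing the bound variable; a clause $C$ is an instance of $C^*$ if $C=C^*\vartheta$ for some substitution $\vartheta$. $\mathit{GInst}_{\mathcal L'}(S)$ is the set of closed (ground) instances of clauses of $S$ over the language $\mathcal L'$. Chains. A chain is $\varepsilon_0\diamond_0\varepsilon_1,\varepsilon_1\diamond_1\varepsilon_2,\dots,\varepsilon_n\diamond_n\varepsilon_{n+1}$;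 it is a contradiction if some $\diamond_i$ is $\prec$ and $\varepsilon_{n+1}=\bar0$ or $\varepsilon_0=\bar1$ or $\varepsilon_0=\varepsilon_{n+1}$. Auxiliary. $\tilde{\mathbb W}$ is a countably infinite set of fresh function symbols. $\mathit{freetermseq}$ of an atom $p(t_1,\dots,t_n)$ is $t_1,\dots,t_n$, of a truth constant is empty, of $Qx\,p(t_0,\dots,t_n)$ is the subsequence of the $t_i$ not containing $x$. $\mathit{ordtcons}(S)=\{c_1\prec c_2: c_1,c_2\in\mathit{tcons}(S)\cup\{\bar0,\bar1\}, c_1<c_2\}$. Basic calculus (on closed clauses; current language $\mathcal L_{\kappa-1}$, current set $S_{\kappa-1}$, input $S$): (B1) from closed $l_0\vee C_0,\dots,l_n\vee C_n\in S_{\kappa-1}$ with $l_0,\dots,l_n$ a contradiction derive $C_0\vee\dots\vee C_n$; (B2) if $\mathit{qatoms}(S)=\emptyset$: for $a\in\mathit{atoms}(S_{\kappa-1})$, $b\in\mathit{tcons}(S_{\kappa-1})\setminus\{\bar0,\bar1\}$ derive $a\prec b\vee a\eqcirc b\vee b\prec a$; if $\mathit{qatoms}(S)\neq\emptyset$: same for $a,b\in\mathit{atoms}(S_{\kappa-1})\cup(\mathit{tcons}(S_{\kappa-1})\setminus\{\bar0,\bar1\})$ not both truth constants; (B3) for $\forall x\,a\in\mathit{qatoms}^\forall(S_{\kappa-1})$ and a ground term $t$ of $\mathcal L_{\kappa-1}$ derive $\forall x\,a\prec a(x/t)\vee\forall x\,a\eqcirc a(x/t)$; for $\exists x\,a$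 derive $a(x/t)\prec\exists x\,a\vee a(x/t)\eqcirc\exists x\,a$; (B4) for $\forall x\,a$ (resp. $\exists x\,a$) in $\mathit{qatoms}(S_{\kappa-1})$ and $b\in\mathit{atoms}(S_{\kappa-1})\cup\mathit{tcons}(S_{\kappa-1})\cup\mathit{qatoms}(S_{\kappa-1})$, take $\tilde w\in\tilde{\mathbb W}$ not in $\mathcal L_{\kappa-1}$ with arity the length of $\mathit{freetermseq}(Qx\,a),\mathit{freetermseq}(b)$, $\gamma=x/\tilde w(\mathit{freetermseq}(Qx\,a),\mathit{freetermseq}(b))$, derive $a\gamma\prec b\vee b\eqcirc\forall x\,a\vee b\prec\forall x\,a$ (resp. $b\prec a\gamma\vee\exists x\,a\eqcirc b\vee\exists x\,a\prec b$), and set $\mathcal L_\kappa=\mathcal L_{\kappa-1}\cup\{\tilde w\}$. A deduction by basic order hyperresolution is $C_1,\dots,C_n$ with $\mathcal L_0=\mathcal L$, $S_0=\emptyset$, $S_\kappa=\{C_1,\dots,C_\kappa\}$, each $C_\kappa\in\mathit{ordtcons}(S)\cup\mathit{GInst}_{\mathcal L_{\kappa-1}}(S)$ or obtained by (B1)–(B4) from $S_{\kappa-1}$. $\mathit{clo}^{\mathcal{BH}}(S)$ is the set of clauses having such a deduction. General calculus: (G1) from variants with disjoint free variables $\bigvee_{j=0}^{k_i}\varepsilon^i_j\diamond^i_j\upsilon^i_j\vee\bigvee_{j=1}^{m_i}l^i_j$ ($i\le n$) of clauses of $S_{\kappa-1}$ derive $(\bigvee_i\bigvee_{j\ge1}l^i_j)\theta$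 where $\theta$ is an mgu making each $\{\varepsilon^i_j\diamond^i_j\upsilon^i_j:j\le k_i\}$ a singleton, unifying $\upsilon^{i-1}_0$ with $\varepsilon^i_0$ ($1\le i\le n$) and unifying $\{a,b\}$ with $(a,b)\in\{(\varepsilon^0_0,\bar1),(\upsilon^n_0,\bar0),(\varepsilon^0_0,\upsilon^n_0)\}$, some $\diamond^i_0$ being $\prec$; (G2) trichotomy as (B2) but, when $\mathit{qatoms}(S)\ne\emptyset$, with $a,b$ taken from $\mathit{atoms}(\mathit{Vrnt}(S_{\kappa-1}))$ with no common variables; (G3) for $\forall x\,a$ derive $\forall x\,a\prec a\vee\forall x\,a\eqcirc a$, for $\exists x\,a$ derive $a\prec\exists x\,a\vee a\eqcirc\exists x\,a$; (G4) as (B4) but with premises from variants, disjoint free variables, and $\gamma$ additionally the identity on the free variables of $Qx\,a$. A deduction by order hyperresolution: each $C_\kappa\in\mathit{ordtcons}(S)\cup S$ or obtained by (G1)–(G4) from variants of clauses of $S_{\kappa-1}$. $\mathit{clo}^{\mathcal H}(S)$ is the set of clauses having such a deduction. -}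

module Defs where

open import Level using (0ℓ)
open import Data.Nat using (ℕ; zero; suc)
open import Data.Product using (Σ; ∃; _×_; _,_; proj₁; proj₂)
open import Data.Sum using (_⊎_)
open import Data.Unit using (⊤)
open import Data.Empty using (⊥)
open import Data.List using (List; []; _∷_; _++_; length; concatMap; map)
open import Data.List.Relation.Unary.All using (All)
open import Data.List.Relation.Unary.Any using (Any)
open import Data.List.Relation.Unary.AllPairs using (AllPairs)
open import Data.List.Membership.Propositional using (_∈_; _∉_)
open import Data.Vec using (Vec; toList; fromList)
import Data.Vec as V
import Data.Vec.Relation.Unary.Any as VAny
open import Relation.Binary.PropositionalEquality using (_≡_; _≢_)
open import Relation.Binary.Structures using (IsStrictTotalOrder)
open import Relation.Nullary using (¬_)

-- A countable first-order language (function and predicate symbols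
-- with arities; countability = an injection into ℕ).

record Lang : Set₁ where
  field
    Fun      : Set
    fAr      : Fun → ℕ
    fEnc     : Fun → ℕ
    fEnc-inj : ∀ {f g} → fEnc f ≡ fEnc g → f ≡ g
    Pred     : Set
    pAr      : Pred → ℕ
    pEnc     : Pred → ℕ
    pEnc-inj : ∀ {p q} → pEnc p ≡ pEnc q → p ≡ q

HasConstant : Lang → Set
HasConstant L = Σ (Lang.Fun L) (λ f → Lang.fAr L f ≡ 0)

-- The countable set C_L ⊆ [0,1] of truth values of the truth constants,
-- containing 0 and 1, given as a countable strict total order with
-- least element c0 (= 0) and greatest element c1 (= 1), c0 < c1.
-- (Only the order of [0,1] restricted to C_L is used by the calculi.)

record TCons : Set₁ where
  field
    TC       : Set
    _<ᶜ_     : TC → TC → Set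
    isSTO    : IsStrictTotalOrder _≡_ _<ᶜ_
    c0 c1    : TC
    c0<c1    : c0 <ᶜ c1
    c0-least : ∀ c → c ≡ c0 ⊎ c0 <ᶜ c
    c1-great : ∀ c → c ≡ c1 ⊎ c <ᶜ c1
    cEnc     : TC → ℕ
    cEnc-inj : ∀ {c d} → cEnc c ≡ cEnc d → c ≡ d

module _ (L : Lang) (T : TCons) where
  open Lang L
  open TCons T

  -- symbols: those of L, and the fresh symbols 𝕎̃ ;
  -- fresh n k is the k-th fresh symbol of arity n
  data Sym : Set where
    base  : Fun → Sym
    fresh : ℕ → ℕ → Sym

  arity : Sym → ℕ
  arity (base f)    = fAr f
  arity (fresh n k) = n

  data Term : Set where
    var : ℕ → Term
    fun : (f : Sym) → Vec Term (arity f) → Term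

  Subst : Set
  Subst = ℕ → Term

  mutual
    substT : Subst → Term → Term
    substT σ (var x)    = σ x
    substT σ (fun f ts) = fun f (substTs σ ts)

    substTs : ∀ {n} → Subst → Vec Term n → Vec Term n
    substTs σ V.[]       = V.[]
    substTs σ (t V.∷ ts) = substT σ t V.∷ substTs σ ts

  mutual
    varsT : Term → List ℕ
    varsT (var x)    = x ∷ []
    varsT (fun f ts) = varsTs ts

    varsTs : ∀ {n} → Vec Term n → List ℕ
    varsTs V.[]       = []
    varsTs (t V.∷ ts) = varsT t ++ varsTs ts

  mutual
    freshT : Term → List (ℕ × ℕ)
    freshT (var x)              = []
    freshT (fun (base f) ts)    = freshTs ts
    freshT (fun (fresh n k) ts) = (n , k) ∷ freshTs ts

    freshTs : ∀ {n} → Vec Term n → List (ℕ × ℕ)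
    freshTs V.[]       = []
    freshTs (t V.∷ ts) = freshT t ++ freshTs ts

  data Atom : Set where
    atom : (p : Pred) → Vec Term (pAr p) → Atom

  -- arguments of a quantified atom  Qx p(t_0,…,t_n) :
  -- ⋆ is an occurrence t_i = x of the bound variable, tm t a term
  -- not containing x (bound variable in locally nameless style)
  data QArg : Set where
    ⋆  : QArg
    tm : Term → QArg

  data Quant : Set where
    ∀q ∃q : Quant

  data Expr : Set where
    at : Atom → Expr
    tc : TC → Expr
    qa : Quant → (p : Pred) → Vec QArg (pAr p) → Expr

  data Rel : Set where
    ≗r ≺r : Rel

  data Lit : Set where
    lit : Expr → Rel → Expr → Lit

  Clause : Set
  Clause = List Lit

  lhs rhs : Lit → Expr
  lhs (lit a _ _) = a
  rhs (lit _ _ b) = b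

  substQ : Subst → QArg → QArg
  substQ σ ⋆      = ⋆
  substQ σ (tm t) = tm (substT σ t)

  substE : Subst → Expr → Expr
  substE σ (at (atom p ts)) = at (atom p (substTs σ ts))
  substE σ (tc c)           = tc c
  substE σ (qa q p as)      = qa q p (V.map (substQ σ) as)

  substL : Subst → Lit → Lit
  substL σ (lit a r b) = lit (substE σ a) r (substE σ b)

  substC : Subst → Clause → Clause
  substC σ C = map (substL σ) C

  varsQs : ∀ {n} → Vec QArg n → List ℕ
  varsQs V.[]          = []
  varsQs (⋆ V.∷ as)    = varsQs as
  varsQs (tm t V.∷ as) = varsT t ++ varsQs as

  varsE : Expr → List ℕ
  varsE (at (atom p ts)) = varsTs ts
  varsE (tc c)           = []
  varsE (qa q p as)      = varsQs as

  varsC : Clause → List ℕ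
  varsC C = concatMap (λ l → varsE (lhs l) ++ varsE (rhs l)) C

  freshQs : ∀ {n} → Vec QArg n → List (ℕ × ℕ)
  freshQs V.[]          = []
  freshQs (⋆ V.∷ as)    = freshQs as
  freshQs (tm t V.∷ as) = freshT t ++ freshQs as

  freshE : Expr → List (ℕ × ℕ)
  freshE (at (atom p ts)) = freshTs ts
  freshE (tc c)           = []
  freshE (qa q p as)      = freshQs as

  freshC : Clause → List (ℕ × ℕ)
  freshC C = concatMap (λ l → freshE (lhs l) ++ freshE (rhs l)) C

  -- Λ lists the fresh symbols added so far: L_κ = L ∪ Λ
  InLangT : List (ℕ × ℕ) → Term → Set
  InLangT Λ t = All (_∈ Λ) (freshT t)

  InLang : List (ℕ × ℕ) → Clause → Set
  InLang Λ C = All (_∈ Λ) (freshC C)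

  ClosedT : Term → Set
  ClosedT t = varsT t ≡ []

  Closed : Clause → Set
  Closed C = varsC C ≡ []

  WFE : Expr → Set
  WFE (qa q p as) = VAny.Any (_≡ ⋆) as
  WFE _           = ⊤

  WFC : Clause → Set
  WFC C = All (λ l → WFE (lhs l) × WFE (rhs l)) C

  ClauseSet : Set₁
  ClauseSet = Clause → Set

  OrderClausesOf : ClauseSet → Set
  OrderClausesOf S = ∀ D → S D → InLang [] D × WFC D

  -- clauses as sets of literals, with ε₁ ≗ ε₂ identified with ε₂ ≗ ε₁

  data _≈L_ : Lit → Lit → Set where
    same : ∀ {l} → l ≈L l
    swap : ∀ {a b} → lit a ≗r b ≈L lit b ≗r a

  _∈L_ : Lit → Clause → Set
  l ∈L C = Any (l ≈L_) C

  _≈C_ : Clause → Clause → Set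
  C ≈C D = All (_∈L D) C × All (_∈L C) D

  _∈C_ : Clause → List Clause → Set
  C ∈C Cs = Any (C ≈C_) Cs

  InstanceOf : Clause → Clause → Set
  InstanceOf C C* = Σ Subst (λ ϑ → C ≈C substC ϑ C*)

  _occursIn_ : Expr → Clause → Set
  e occursIn C = Any (λ l → e ≡ lhs l ⊎ e ≡ rhs l) C

  _occursInS_ : Expr → List Clause → Set
  e occursInS Cs = Any (e occursIn_) Cs

  isAtom isTC isQA : Expr → Set
  isAtom (at _) = ⊤
  isAtom _      = ⊥
  isTC (tc _) = ⊤
  isTC _      = ⊥
  isQA (qa _ _ _) = ⊤
  isQA _          = ⊥

  InnerTC : Expr → Set
  InnerTC e = Σ TC (λ c → e ≡ tc c × c ≢ c0 × c ≢ c1)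

  HasQ : ClauseSet → Set
  HasQ S = Σ Clause (λ D → S D × Σ Expr (λ e → isQA e × e occursIn D))

  NoQ : ClauseSet → Set
  NoQ S = ¬ HasQ S

  TConsOf : ClauseSet → TC → Set
  TConsOf S c = c ≡ c0 ⊎ c ≡ c1 ⊎ Σ Clause (λ D → S D × tc c occursIn D)

  OrdTCons : ClauseSet → Clause → Set
  OrdTCons S C = Σ TC (λ a → Σ TC (λ b →
    TConsOf S a × TConsOf S b × a <ᶜ b × C ≈C (lit (tc a) ≺r (tc b) ∷ [])))

  instArgs : ∀ {n} → Vec QArg n → Term → Vec Term n
  instArgs as t = V.map (λ { ⋆ → t ; (tm s) → s }) as

  ftsQ : ∀ {n} → Vec QArg n → List Term
  ftsQ V.[]          = []
  ftsQ (⋆ V.∷ as)    = ftsQ as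
  ftsQ (tm t V.∷ as) = t ∷ ftsQ as

  freetermseq : Expr → List Term
  freetermseq (at (atom p ts)) = toList ts
  freetermseq (tc c)           = []
  freetermseq (qa q p as)      = ftsQ as

  w-arity : Expr → Expr → ℕ
  w-arity e b = length (freetermseq e ++ freetermseq b)

  w-term : Expr → Expr → ℕ → Term
  w-term e b k = fun (fresh (w-arity e b) k) (fromList (freetermseq e ++ freetermseq b))

  triClause : Expr → Expr → Clause
  triClause a b = lit a ≺r b ∷ lit a ≗r b ∷ lit b ≺r a ∷ []

  qClause : Quant → Expr → Expr → Clause
  qClause ∀q e a = lit e ≺r a ∷ lit e ≗r a ∷ []
  qClause ∃q e a = lit a ≺r e ∷ lit a ≗r e ∷ []

  wClause : Quant → Expr → Expr → Expr → Clause
  wClause ∀q e a b = lit a ≺r b ∷ lit b ≗r e ∷ lit b ≺r e ∷ []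
  wClause ∃q e a b = lit b ≺r a ∷ lit e ≗r b ∷ lit e ≺r b ∷ []

  record Link : Set where
    constructor mkLink
    field
      left  : Expr
      rel   : Rel
      right : Expr
      rest  : Clause

  linkLit : Link → Lit
  linkLit k = lit (Link.left k) (Link.rel k) (Link.right k)

  Chained : Link → List Link → Set
  Chained k []       = ⊤
  Chained k (k' ∷ ks) = Link.right k ≡ Link.left k' × Chained k' ks

  lastLink : Link → List Link → Link
  lastLink k []        = k
  lastLink k (k' ∷ ks) = lastLink k' ks

  IsContradiction : Link → List Link → Set
  IsContradiction k ks =
    Chained k ks ×
    Any (λ j → Link.rel j ≡ ≺r) (k ∷ ks) ×
    (Link.right (lastLink k ks) ≡ tc c0 ⊎ Link.left k ≡ tc c1 ⊎
     Link.left k ≡ Link.right (lastLink k ks))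

  -- basic order hyperresolution (S input, Λ current language L_{κ-1},
  -- Cs = S_{κ-1})

  data BHStep (S : ClauseSet) (Λ : List (ℕ × ℕ)) (Cs : List Clause)
       : Clause → List (ℕ × ℕ) → Set where
    ordtc : ∀ {C} → OrdTCons S C → BHStep S Λ Cs C Λ
    ginst : ∀ {C} (D : Clause) (ϑ : Subst) → S D → C ≈C substC ϑ D →
            Closed C → InLang Λ C → BHStep S Λ Cs C Λ
    b1    : ∀ {C} (k : Link) (ks : List Link) →
            All (λ j → Closed (linkLit j ∷ Link.rest j) ×
                       (linkLit j ∷ Link.rest j) ∈C Cs) (k ∷ ks) →
            IsContradiction k ks →
            C ≈C concatMap Link.rest (k ∷ ks) → BHStep S Λ Cs C Λ
    b2-noQ : ∀ {C} (a b : Expr) → NoQ S →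
            isAtom a → a occursInS Cs → InnerTC b → b occursInS Cs →
            C ≈C triClause a b → BHStep S Λ Cs C Λ
    b2-Q  : ∀ {C} (a b : Expr) → HasQ S →
            (isAtom a ⊎ InnerTC a) → a occursInS Cs →
            (isAtom b ⊎ InnerTC b) → b occursInS Cs →
            ¬ (isTC a × isTC b) →
            C ≈C triClause a b → BHStep S Λ Cs C Λ
    b3    : ∀ {C} (q : Quant) (p : Pred) (as : Vec QArg (pAr p)) (t : Term) →
            qa q p as occursInS Cs → ClosedT t → InLangT Λ t →
            C ≈C qClause q (qa q p as) (at (atom p (instArgs as t))) →
            BHStep S Λ Cs C Λ
    b4    : ∀ {C} (q : Quant) (p : Pred) (as : Vec QArg (pAr p)) (b : Expr)
            (k : ℕ) →
            qa q p as occursInS Cs → b occursInS Cs →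
            (w-arity (qa q p as) b , k) ∉ Λ →
            C ≈C wClause q (qa q p as)
                   (at (atom p (instArgs as (w-term (qa q p as) b k)))) b →
            BHStep S Λ Cs C ((w-arity (qa q p as) b , k) ∷ Λ)

  -- deductions, stored in reverse: the head is the last clause C_n
  data BHDed (S : ClauseSet) : List (ℕ × ℕ) → List Clause → Set where
    start : BHDed S [] []
    step  : ∀ {Λ Λ' Cs C} → BHDed S Λ Cs → BHStep S Λ Cs C Λ' →
            BHDed S Λ' (C ∷ Cs)

  cloBH : ClauseSet → Clause → Set
  cloBH S C = Σ (List (ℕ × ℕ)) (λ Λ → Σ Clause (λ C' → Σ (List Clause) (λ Cs →
    BHDed S Λ (C' ∷ Cs) × C ≈C C')))

  Injective : (ℕ → ℕ) → Set
  Injective ρ = ∀ {x y} → ρ x ≡ ρ y → x ≡ y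

  VariantOf : Clause → Clause → Set
  VariantOf D' D = Σ (ℕ → ℕ) (λ ρ → Injective ρ × D' ≈C substC (λ x → var (ρ x)) D)

  InVrnt : List Clause → Clause → Set
  InVrnt Cs D' = Any (VariantOf D') Cs

  _occursInVrnt_ : Expr → List Clause → Set
  e occursInVrnt Cs = Σ Clause (λ D' → InVrnt Cs D' × e occursIn D')

  DisjointV : List ℕ → List ℕ → Set
  DisjointV xs ys = ∀ {x} → x ∈ xs → x ∉ ys

  Unifies : Subst → List (Expr × Expr) → Set
  Unifies θ eqs = All (λ ab → substE θ (proj₁ ab) ≡ substE θ (proj₂ ab)) eqs

  IsMGU : Subst → List (Expr × Expr) → Set
  IsMGU θ eqs = Unifies θ eqs ×
    (∀ σ → Unifies σ eqs → Σ Subst (λ δ → ∀ x → σ x ≡ substT δ (θ x)))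

  record GPrem : Set where
    constructor mkGPrem
    field
      rel   : Rel
      ε₀ υ₀ : Expr
      extra : List (Expr × Expr)
      rest  : Clause

  gClause : GPrem → Clause
  gClause P = lit (GPrem.ε₀ P) (GPrem.rel P) (GPrem.υ₀ P) ∷
              map (λ eu → lit (proj₁ eu) (GPrem.rel P) (proj₂ eu)) (GPrem.extra P)
              ++ GPrem.rest P

  -- equations making {ε_j ◇ υ_j : j ≤ k} a singleton
  groupEqs : GPrem → List (Expr × Expr)
  groupEqs P = concatMap (λ eu → (proj₁ eu , GPrem.ε₀ P) ∷ (proj₂ eu , GPrem.υ₀ P) ∷ [])
                         (GPrem.extra P)

  linkEqs : GPrem → List GPrem → List (Expr × Expr)
  linkEqs P []       = []
  linkEqs P (P' ∷ Ps) = (GPrem.υ₀ P , GPrem.ε₀ P') ∷ linkEqs P' Ps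

  lastG : GPrem → List GPrem → GPrem
  lastG P []        = P
  lastG P (P' ∷ Ps) = lastG P' Ps

  data EndKind : Set where
    first-one last-zero first-last : EndKind

  endEq : EndKind → GPrem → List GPrem → Expr × Expr
  endEq first-one  P Ps = (GPrem.ε₀ P , tc c1)
  endEq last-zero  P Ps = (GPrem.υ₀ (lastG P Ps) , tc c0)
  endEq first-last P Ps = (GPrem.ε₀ P , GPrem.υ₀ (lastG P Ps))

  g1Eqs : EndKind → GPrem → List GPrem → List (Expr × Expr)
  g1Eqs ek P Ps = concatMap groupEqs (P ∷ Ps) ++ linkEqs P Ps ++ endEq ek P Ps ∷ []

  data HStep (S : ClauseSet) (Λ : List (ℕ × ℕ)) (Cs : List Clause)
       : Clause → List (ℕ × ℕ) → Set where
    ordtc : ∀ {C} → OrdTCons S C → HStep S Λ Cs C Λ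
    input : ∀ {C} (D : Clause) → S D → C ≈C D → HStep S Λ Cs C Λ
    g1    : ∀ {C} (P : GPrem) (Ps : List GPrem) (ek : EndKind) (θ : Subst) →
            All (λ P' → InVrnt Cs (gClause P')) (P ∷ Ps) →
            AllPairs (λ P' P'' → DisjointV (varsC (gClause P')) (varsC (gClause P'')))
                     (P ∷ Ps) →
            Any (λ P' → GPrem.rel P' ≡ ≺r) (P ∷ Ps) →
            IsMGU θ (g1Eqs ek P Ps) →
            C ≈C substC θ (concatMap GPrem.rest (P ∷ Ps)) → HStep S Λ Cs C Λ
    g2-noQ : ∀ {C} (a b : Expr) → NoQ S →
            isAtom a → a occursInVrnt Cs → InnerTC b → b occursInVrnt Cs →
            C ≈C triClause a b → HStep S Λ Cs C Λ
    g2-Q  : ∀ {C} (a b : Expr) → HasQ S →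
            (isAtom a ⊎ InnerTC a) → a occursInVrnt Cs →
            (isAtom b ⊎ InnerTC b) → b occursInVrnt Cs →
            ¬ (isTC a × isTC b) → DisjointV (varsE a) (varsE b) →
            C ≈C triClause a b → HStep S Λ Cs C Λ
    g3    : ∀ {C} (q : Quant) (p : Pred) (as : Vec QArg (pAr p)) (x : ℕ) →
            qa q p as occursInVrnt Cs → x ∉ varsE (qa q p as) →
            C ≈C qClause q (qa q p as) (at (atom p (instArgs as (var x)))) →
            HStep S Λ Cs C Λ
    g4    : ∀ {C} (q : Quant) (p : Pred) (as : Vec QArg (pAr p)) (b : Expr)
            (D₁ D₂ : Clause) (k : ℕ) →
            InVrnt Cs D₁ → InVrnt Cs D₂ → DisjointV (varsC D₁) (varsC D₂) →
            qa q p as occursIn D₁ → b occursIn D₂ →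
            (w-arity (qa q p as) b , k) ∉ Λ →
            C ≈C wClause q (qa q p as)
                   (at (atom p (instArgs as (w-term (qa q p as) b k)))) b →
            HStep S Λ Cs C ((w-arity (qa q p as) b , k) ∷ Λ)

  data HDed (S : ClauseSet) : List (ℕ × ℕ) → List Clause → Set where
    start : HDed S [] []
    step  : ∀ {Λ Λ' Cs C} → HDed S Λ Cs → HStep S Λ Cs C Λ' →
            HDed S Λ' (C ∷ Cs)

  cloH : ClauseSet → Clause → Set
  cloH S C = Σ (List (ℕ × ℕ)) (λ Λ → Σ Clause (λ C' → Σ (List Clause) (λ Cs →
    HDed S Λ (C' ∷ Cs) × C ≈C C')))

{-# OPTIONS --safe #-}
-- The basic calculus is lifted step by step: alongside a basic deduction
-- C₁ … Cₙ one builds a general deduction C₁* … Cₙ* with each Cᵢ an instance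
-- of Cᵢ*.  A basic inference uses ground instances ϑᵢ of earlier lifted
-- clauses; renaming these apart (even and odd variables) lets a single
-- substitution σ instantiate all of them at once.  The general rule is then
-- applied to the renamed variants: for (G1) σ solves the unification problem
-- of the lifted chain, so it factors through its most general unifier θ,
-- which exhibits the basic resolvent as an instance of the general one.  For
-- (G2)–(G4) the general conclusion has the shape of the basic one; the fresh
-- symbol w̃ keeps its arity because freetermseq commutes with substitution.
module Submission where

open import Defs
open import Data.Product using (Σ; _×_; _,_; proj₁; proj₂)
open import Data.Sum using (_⊎_; inj₁; inj₂; [_,_]′)
open import Data.Unit using (tt)
open import Data.Empty using (⊥-elim)
open import Data.Nat using (ℕ; zero; suc; _+_; _<_; _≤_; z≤n; s≤s)
import Data.Nat as ℕ
import Data.Nat.Properties as ℕP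
open import Data.List using (List; []; _∷_; _++_; length; concatMap; map)
import Data.List.Properties as ListP
open import Data.List.Relation.Unary.All using (All; []; _∷_)
import Data.List.Relation.Unary.All as All
import Data.List.Relation.Unary.All.Properties as AllP
open import Data.List.Relation.Unary.Any using (Any; here; there)
import Data.List.Relation.Unary.Any as Any
import Data.List.Relation.Unary.Any.Properties as AnyP
open import Data.List.Relation.Unary.AllPairs using (AllPairs; []; _∷_)
open import Data.List.Relation.Binary.Pointwise using (Pointwise; []; _∷_)
open import Data.List.Membership.Propositional using (_∈_; _∉_)
open import Data.List.Membership.DecPropositional ℕ._≟_ using (_∈?_)
open import Data.Vec using (Vec; toList; fromList)
import Data.Vec as V
import Data.Vec.Properties as VecP
open import Relation.Binary.PropositionalEquality
open import Relation.Nullary using (¬_; Dec; yes; no)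
open import Relation.Nullary.Decidable using (map′; _×-dec_; _⊎-dec_)
open import Function using (_∘_)

module Lifting (L : Lang) (T : TCons) where
  open Lang L
  open TCons T

  private
    Tm = Term L T
    QA = QArg L T
    Ex = Expr L T
    Lt = Lit L T
    Cl = Clause L T
    Sb = Subst L T
    sT = substT L T
    sTs = substTs L T
    sQ = substQ L T
    sE = substE L T
    sL = substL L T
    sC = substC L T
    _≈ₗ_ = _≈L_ L T
    _∈ₗ_ = _∈L_ L T
    _≈c_ = _≈C_ L T
    _occurs-in_ = _occursIn_ L T
    LinkT = Link L T

  _∘ₛ_ : Sb → Sb → Sb
  (τ ∘ₛ ρ) x = sT τ (ρ x)

  rename : (ℕ → ℕ) → Sb
  rename π x = var (π x)

  mutual
    substT-cong : ∀ {σ τ} → σ ≗ τ → sT σ ≗ sT τ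
    substT-cong h (var x)    = h x
    substT-cong h (fun f ts) = cong (fun f) (substTs-cong h ts)

    substTs-cong : ∀ {σ τ n} → σ ≗ τ → (ts : Vec Tm n) → sTs σ ts ≡ sTs τ ts
    substTs-cong h V.[]       = refl
    substTs-cong h (t V.∷ ts) = cong₂ V._∷_ (substT-cong h t) (substTs-cong h ts)

  substQ-cong : ∀ {σ τ} → σ ≗ τ → sQ σ ≗ sQ τ
  substQ-cong h ⋆      = refl
  substQ-cong h (tm t) = cong tm (substT-cong h t)

  substE-cong : ∀ {σ τ} → σ ≗ τ → sE σ ≗ sE τ
  substE-cong h (at (atom p ts)) = cong (at ∘ atom p) (substTs-cong h ts)
  substE-cong h (tc c)           = refl
  substE-cong h (qa q p as)      = cong (qa q p) (VecP.map-cong (substQ-cong h) as)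

  substL-cong : ∀ {σ τ} → σ ≗ τ → sL σ ≗ sL τ
  substL-cong h (lit a r b) = cong₂ (λ u v → lit u r v) (substE-cong h a) (substE-cong h b)

  substC-cong : ∀ {σ τ} → σ ≗ τ → sC σ ≗ sC τ
  substC-cong h = ListP.map-cong (substL-cong h)

  mutual
    substT-∘ : ∀ {τ ρ} t → sT τ (sT ρ t) ≡ sT (τ ∘ₛ ρ) t
    substT-∘ (var x)    = refl
    substT-∘ (fun f ts) = cong (fun f) (substTs-∘ ts)

    substTs-∘ : ∀ {τ ρ n} (ts : Vec Tm n) → sTs τ (sTs ρ ts) ≡ sTs (τ ∘ₛ ρ) ts
    substTs-∘ V.[]       = refl
    substTs-∘ (t V.∷ ts) = cong₂ V._∷_ (substT-∘ t) (substTs-∘ ts)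

  substQ-∘ : ∀ {τ ρ} a → sQ τ (sQ ρ a) ≡ sQ (τ ∘ₛ ρ) a
  substQ-∘ ⋆      = refl
  substQ-∘ (tm t) = cong tm (substT-∘ t)

  substQs-∘ : ∀ {τ ρ n} (as : Vec QA n) → V.map (sQ τ) (V.map (sQ ρ) as) ≡ V.map (sQ (τ ∘ₛ ρ)) as
  substQs-∘ as = trans (sym (VecP.map-∘ _ _ as)) (VecP.map-cong substQ-∘ as)

  substE-∘ : ∀ {τ ρ} e → sE τ (sE ρ e) ≡ sE (τ ∘ₛ ρ) e
  substE-∘ (at (atom p ts)) = cong (at ∘ atom p) (substTs-∘ ts)
  substE-∘ (tc c)           = refl
  substE-∘ (qa q p as)      = cong (qa q p) (substQs-∘ as)

  substL-∘ : ∀ {τ ρ} l → sL τ (sL ρ l) ≡ sL (τ ∘ₛ ρ) l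
  substL-∘ (lit a r b) = cong₂ (λ u v → lit u r v) (substE-∘ a) (substE-∘ b)

  substC-∘ : ∀ {τ ρ} C → sC τ (sC ρ C) ≡ sC (τ ∘ₛ ρ) C
  substC-∘ C = trans (sym (ListP.map-∘ C)) (ListP.map-cong substL-∘ C)

  mutual
    substT-id : ∀ t → sT var t ≡ t
    substT-id (var x)    = refl
    substT-id (fun f ts) = cong (fun f) (substTs-id ts)

    substTs-id : ∀ {n} (ts : Vec Tm n) → sTs var ts ≡ ts
    substTs-id V.[]       = refl
    substTs-id (t V.∷ ts) = cong₂ V._∷_ (substT-id t) (substTs-id ts)

  substQ-id : ∀ a → sQ var a ≡ a
  substQ-id ⋆      = refl
  substQ-id (tm t) = cong tm (substT-id t)

  substE-id : ∀ e → sE var e ≡ e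
  substE-id (at (atom p ts)) = cong (at ∘ atom p) (substTs-id ts)
  substE-id (tc c)           = refl
  substE-id (qa q p as)      = cong (qa q p) (trans (VecP.map-cong substQ-id as) (VecP.map-id as))

  substC-id : ∀ C → sC var C ≡ C
  substC-id C = trans (ListP.map-cong substL-id C) (ListP.map-id C)
    where
    substL-id : ∀ l → sL var l ≡ l
    substL-id (lit a r b) = cong₂ (λ u v → lit u r v) (substE-id a) (substE-id b)

  mutual
    substT-local : ∀ {σ τ} t → (∀ {x} → x ∈ varsT L T t → σ x ≡ τ x) → sT σ t ≡ sT τ t
    substT-local (var x)    h = h (here refl)
    substT-local (fun f ts) h = cong (fun f) (substTs-local ts h)

    substTs-local : ∀ {σ τ n} (ts : Vec Tm n) → (∀ {x} → x ∈ varsTs L T ts → σ x ≡ τ x) →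
                    sTs σ ts ≡ sTs τ ts
    substTs-local V.[]       h = refl
    substTs-local (t V.∷ ts) h =
      cong₂ V._∷_ (substT-local t (h ∘ AnyP.++⁺ˡ)) (substTs-local ts (h ∘ AnyP.++⁺ʳ (varsT L T t)))

  _⊆ₗ_ : Cl → Cl → Set
  C ⊆ₗ D = All (_∈ₗ D) C

  ≈ₗ-sym : ∀ {l m} → l ≈ₗ m → m ≈ₗ l
  ≈ₗ-sym same = same
  ≈ₗ-sym swap = swap

  ≈ₗ-trans : ∀ {l m n} → l ≈ₗ m → m ≈ₗ n → l ≈ₗ n
  ≈ₗ-trans same q    = q
  ≈ₗ-trans swap same = swap
  ≈ₗ-trans swap swap = same

  ≈ₗ-subst : ∀ σ {l m} → l ≈ₗ m → sL σ l ≈ₗ sL σ m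
  ≈ₗ-subst σ same = same
  ≈ₗ-subst σ swap = swap

  ∈ₗ-resp-≈ₗ : ∀ {l m C} → l ≈ₗ m → m ∈ₗ C → l ∈ₗ C
  ∈ₗ-resp-≈ₗ e = Any.map (≈ₗ-trans e)

  ∈⇒∈ₗ : ∀ {l C} → l ∈ C → l ∈ₗ C
  ∈⇒∈ₗ = Any.map (λ { refl → same })

  ∈ₗ-subst : ∀ σ {l C} → l ∈ₗ C → sL σ l ∈ₗ sC σ C
  ∈ₗ-subst σ = AnyP.map⁺ ∘ Any.map (≈ₗ-subst σ)

  ∈ₗ-subst⁻ : ∀ σ C {m} → m ∈ₗ sC σ C → Σ Lt (λ l → l ∈ C × m ≈ₗ sL σ l)
  ∈ₗ-subst⁻ σ (l ∷ C) (here e)  = l , here refl , e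
  ∈ₗ-subst⁻ σ (l ∷ C) (there m) with ∈ₗ-subst⁻ σ C m
  ... | l′ , l′∈C , e = l′ , there l′∈C , e

  ⊆ₗ-refl : ∀ C → C ⊆ₗ C
  ⊆ₗ-refl []      = []
  ⊆ₗ-refl (l ∷ C) = here same ∷ All.map there (⊆ₗ-refl C)

  ∈ₗ-⊆ₗ : ∀ {l B C} → l ∈ₗ B → B ⊆ₗ C → l ∈ₗ C
  ∈ₗ-⊆ₗ (here e)  (m ∷ _)  = ∈ₗ-resp-≈ₗ e m
  ∈ₗ-⊆ₗ (there x) (_ ∷ ms) = ∈ₗ-⊆ₗ x ms

  ⊆ₗ-trans : ∀ {A B C} → A ⊆ₗ B → B ⊆ₗ C → A ⊆ₗ C
  ⊆ₗ-trans p q = All.map (λ m → ∈ₗ-⊆ₗ m q) p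

  ⊆ₗ-++ : ∀ {A B C D} → A ⊆ₗ C → B ⊆ₗ D → (A ++ B) ⊆ₗ (C ++ D)
  ⊆ₗ-++ {C = C} {D} p q = AllP.++⁺ (All.map AnyP.++⁺ˡ p) (All.map (AnyP.++⁺ʳ C) q)

  ≈c-refl : ∀ {C} → C ≈c C
  ≈c-refl {C} = ⊆ₗ-refl C , ⊆ₗ-refl C

  ≈c-sym : ∀ {C D} → C ≈c D → D ≈c C
  ≈c-sym (p , q) = q , p

  ≈c-trans : ∀ {A B C} → A ≈c B → B ≈c C → A ≈c C
  ≈c-trans (p , q) (p′ , q′) = ⊆ₗ-trans p p′ , ⊆ₗ-trans q′ q

  ≈c-++ : ∀ {A B C D} → A ≈c C → B ≈c D → (A ++ B) ≈c (C ++ D)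
  ≈c-++ (p , q) (p′ , q′) = ⊆ₗ-++ p p′ , ⊆ₗ-++ q q′

  ≡⇒≈c : ∀ {C D} → C ≡ D → C ≈c D
  ≡⇒≈c refl = ≈c-refl

  ≈c-instance : ∀ {C D} ϑ D* → C ≈c D → sC ϑ D* ≡ D → InstanceOf L T C D*
  ≈c-instance ϑ D* C≈D refl = ϑ , C≈D

  ≟-from-injection : ∀ {A : Set} (enc : A → ℕ) → (∀ {a b} → enc a ≡ enc b → a ≡ b) →
                     (a b : A) → Dec (a ≡ b)
  ≟-from-injection enc enc-inj a b = map′ enc-inj (cong enc) (enc a ℕ.≟ enc b)

  _≟ₛ_ : (f g : Sym L T) → Dec (f ≡ g)
  base f    ≟ₛ base g     = map′ (cong base) (λ { refl → refl }) (≟-from-injection fEnc fEnc-inj f g)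
  base _    ≟ₛ fresh _ _  = no (λ ())
  fresh _ _ ≟ₛ base _     = no (λ ())
  fresh n k ≟ₛ fresh m j  with n ℕ.≟ m | k ℕ.≟ j
  ... | yes refl | yes refl = yes refl
  ... | no n≢m   | _        = no (λ { refl → n≢m refl })
  ... | _        | no k≢j   = no (λ { refl → k≢j refl })

  fun-injective : ∀ {f} {ts us : Vec Tm (arity L T f)} → fun f ts ≡ fun f us → ts ≡ us
  fun-injective refl = refl

  mutual
    _≟ₜ_ : (t u : Tm) → Dec (t ≡ u)
    var x    ≟ₜ var y    = map′ (cong var) (λ { refl → refl }) (x ℕ.≟ y)
    var _    ≟ₜ fun _ _  = no (λ ())
    fun _ _  ≟ₜ var _    = no (λ ())
    fun f ts ≟ₜ fun g us with f ≟ₛ g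
    ... | no f≢g  = no (λ { refl → f≢g refl })
    ... | yes refl = map′ (cong (fun f)) fun-injective (ts ≟ₜₛ us)

    _≟ₜₛ_ : ∀ {n} (ts us : Vec Tm n) → Dec (ts ≡ us)
    V.[]       ≟ₜₛ V.[]       = yes refl
    (t V.∷ ts) ≟ₜₛ (u V.∷ us) =
      map′ (λ (p , q) → cong₂ V._∷_ p q) VecP.∷-injective ((t ≟ₜ u) ×-dec (ts ≟ₜₛ us))

  _≟q_ : (a b : QA) → Dec (a ≡ b)
  ⋆    ≟q ⋆    = yes refl
  ⋆    ≟q tm _ = no (λ ())
  tm _ ≟q ⋆    = no (λ ())
  tm t ≟q tm u = map′ (cong tm) (λ { refl → refl }) (t ≟ₜ u)

  ≟-quant : (q q′ : Quant L T) → Dec (q ≡ q′)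
  ≟-quant ∀q ∀q = yes refl
  ≟-quant ∀q ∃q = no (λ ())
  ≟-quant ∃q ∀q = no (λ ())
  ≟-quant ∃q ∃q = yes refl

  _≟ₑ_ : (a b : Ex) → Dec (a ≡ b)
  at (atom p ts) ≟ₑ at (atom p′ us) with ≟-from-injection pEnc pEnc-inj p p′
  ... | no p≢p′  = no (λ { refl → p≢p′ refl })
  ... | yes refl = map′ (cong (at ∘ atom p)) (λ { refl → refl }) (ts ≟ₜₛ us)
  tc c ≟ₑ tc d = map′ (cong tc) (λ { refl → refl }) (≟-from-injection cEnc cEnc-inj c d)
  qa q p as ≟ₑ qa q′ p′ bs with ≟-quant q q′ | ≟-from-injection pEnc pEnc-inj p p′
  ... | no q≢q′  | _         = no (λ { refl → q≢q′ refl })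
  ... | _        | no p≢p′   = no (λ { refl → p≢p′ refl })
  ... | yes refl | yes refl  = map′ (cong (qa q p)) (λ { refl → refl }) (VecP.≡-dec _≟q_ as bs)
  at _     ≟ₑ tc _     = no (λ ())
  at _     ≟ₑ qa _ _ _ = no (λ ())
  tc _     ≟ₑ at _     = no (λ ())
  tc _     ≟ₑ qa _ _ _ = no (λ ())
  qa _ _ _ ≟ₑ at _     = no (λ ())
  qa _ _ _ ≟ₑ tc _     = no (λ ())

  ≟-rel : (r r′ : Rel L T) → Dec (r ≡ r′)
  ≟-rel ≗r ≗r = yes refl
  ≟-rel ≗r ≺r = no (λ ())
  ≟-rel ≺r ≗r = no (λ ())
  ≟-rel ≺r ≺r = yes refl

  _≟ₗ_ : (l m : Lt) → Dec (l ≡ m)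
  lit a r b ≟ₗ lit a′ r′ b′ with a ≟ₑ a′ | ≟-rel r r′ | b ≟ₑ b′
  ... | yes refl | yes refl | yes refl = yes refl
  ... | no a≢a′  | _        | _        = no (λ { refl → a≢a′ refl })
  ... | _        | no r≢r′  | _        = no (λ { refl → r≢r′ refl })
  ... | _        | _        | no b≢b′  = no (λ { refl → b≢b′ refl })

  _≈ₗ?_ : (l m : Lt) → Dec (l ≈ₗ m)
  lit a ≺r b ≈ₗ? m = map′ (λ { refl → same }) (λ { same → refl }) (lit a ≺r b ≟ₗ m)
  lit a ≗r b ≈ₗ? m =
    map′ [ (λ { refl → same }) , (λ { refl → swap }) ]′ (λ { same → inj₁ refl ; swap → inj₂ refl })
         ((lit a ≗r b ≟ₗ m) ⊎-dec (lit b ≗r a ≟ₗ m))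

  _∈ₗ?_ : (l : Lt) (C : Cl) → Dec (l ∈ₗ C)
  l ∈ₗ? C = Any.any? (l ≈ₗ?_) C

  -- Most general unifiers

  TermEq : Set
  TermEq = Tm × Tm

  Solves : Sb → List TermEq → Set
  Solves θ E = All (λ e → sT θ (proj₁ e) ≡ sT θ (proj₂ e)) E

  HasMGU : (Sb → Set) → Set
  HasMGU U = Σ Sb (λ θ → U θ × (∀ τ → U τ → Σ Sb (λ δ → τ ≗ δ ∘ₛ θ)))

  HasMGU-resp : ∀ {U U′ : Sb → Set} → (∀ θ → U θ → U′ θ) → (∀ θ → U′ θ → U θ) →
                HasMGU U → HasMGU U′
  HasMGU-resp to from (θ , u , general) = θ , to θ u , (λ τ u′ → general τ (from τ u′))

  SameSolutions : (Sb → Set) → List TermEq → Set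
  SameSolutions U E = ∀ θ → (U θ → Solves θ E) × (Solves θ E → U θ)

  mutual
    size : Tm → ℕ
    size (var x)    = 1
    size (fun f ts) = suc (sizes ts)

    sizes : ∀ {n} → Vec Tm n → ℕ
    sizes V.[]       = 0
    sizes (t V.∷ ts) = size t + sizes ts

  lhsSize : Sb → List TermEq → ℕ
  lhsSize σ []      = 0
  lhsSize σ (e ∷ E) = size (sT σ (proj₁ e)) + lhsSize σ E

  lhsSize-++ : ∀ σ E E′ → lhsSize σ (E ++ E′) ≡ lhsSize σ E + lhsSize σ E′
  lhsSize-++ σ []      E′ = refl
  lhsSize-++ σ (e ∷ E) E′ =
    trans (cong (size (sT σ (proj₁ e)) +_) (lhsSize-++ σ E E′)) (sym (ℕP.+-assoc (size (sT σ (proj₁ e))) _ _))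

  mutual
    size-var≤ : ∀ σ {x} t → x ∈ varsT L T t → size (σ x) ≤ size (sT σ t)
    size-var≤ σ (var y)    (here refl) = ℕP.≤-refl
    size-var≤ σ (fun f ts) x∈ts        = ℕP.m≤n⇒m≤1+n (size-var≤ₛ σ ts x∈ts)

    size-var≤ₛ : ∀ σ {x n} (ts : Vec Tm n) → x ∈ varsTs L T ts → size (σ x) ≤ sizes (sTs σ ts)
    size-var≤ₛ σ (t V.∷ ts) x∈ with AnyP.++⁻ (varsT L T t) x∈
    ... | inj₁ x∈t  = ℕP.≤-trans (size-var≤ σ t x∈t) (ℕP.m≤m+n _ _)
    ... | inj₂ x∈ts = ℕP.≤-trans (size-var≤ₛ σ ts x∈ts) (ℕP.m≤n+m _ _)

  zipEqs : ∀ {n} → Vec Tm n → Vec Tm n → List TermEq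
  zipEqs V.[]       V.[]       = []
  zipEqs (t V.∷ ts) (u V.∷ us) = (t , u) ∷ zipEqs ts us

  Solves-zipEqs⁺ : ∀ θ {n} (ts us : Vec Tm n) → sTs θ ts ≡ sTs θ us → Solves θ (zipEqs ts us)
  Solves-zipEqs⁺ θ V.[]       V.[]       e = []
  Solves-zipEqs⁺ θ (t V.∷ ts) (u V.∷ us) e =
    VecP.∷-injectiveˡ e ∷ Solves-zipEqs⁺ θ ts us (VecP.∷-injectiveʳ e)

  Solves-zipEqs⁻ : ∀ θ {n} (ts us : Vec Tm n) → Solves θ (zipEqs ts us) → sTs θ ts ≡ sTs θ us
  Solves-zipEqs⁻ θ V.[]       V.[]       []       = refl
  Solves-zipEqs⁻ θ (t V.∷ ts) (u V.∷ us) (e ∷ es) = cong₂ V._∷_ e (Solves-zipEqs⁻ θ ts us es)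

  lhsSize-zipEqs : ∀ σ {n} (ts us : Vec Tm n) → lhsSize σ (zipEqs ts us) ≡ sizes (sTs σ ts)
  lhsSize-zipEqs σ V.[]       V.[]       = refl
  lhsSize-zipEqs σ (t V.∷ ts) (u V.∷ us) = cong (size (sT σ t) +_) (lhsSize-zipEqs σ ts us)

  substEqs : Sb → List TermEq → List TermEq
  substEqs ρ = map (λ e → sT ρ (proj₁ e) , sT ρ (proj₂ e))

  Solves-substEqs⁺ : ∀ {τ ρ} E → Solves (τ ∘ₛ ρ) E → Solves τ (substEqs ρ E)
  Solves-substEqs⁺ []            []       = []
  Solves-substEqs⁺ ((s , t) ∷ E) (u ∷ us) = trans (substT-∘ s) (trans u (sym (substT-∘ t))) ∷ Solves-substEqs⁺ E us

  Solves-substEqs⁻ : ∀ {τ ρ} E → Solves τ (substEqs ρ E) → Solves (τ ∘ₛ ρ) E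
  Solves-substEqs⁻ []            []       = []
  Solves-substEqs⁻ ((s , t) ∷ E) (u ∷ us) = trans (sym (substT-∘ s)) (trans u (substT-∘ t)) ∷ Solves-substEqs⁻ E us

  Solves-cong : ∀ {σ τ} → σ ≗ τ → ∀ E → Solves σ E → Solves τ E
  Solves-cong h []            []       = []
  Solves-cong h ((s , t) ∷ E) (u ∷ us) = trans (sym (substT-cong h s)) (trans u (substT-cong h t)) ∷ Solves-cong h E us

  lhsSize-substEqs : ∀ σ ρ → (σ ∘ₛ ρ) ≗ σ → ∀ E → lhsSize σ (substEqs ρ E) ≡ lhsSize σ E
  lhsSize-substEqs σ ρ h []            = refl
  lhsSize-substEqs σ ρ h ((s , t) ∷ E) =
    cong₂ _+_ (cong size (trans (substT-∘ s) (substT-cong h s))) (lhsSize-substEqs σ ρ h E)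

  _↦_ : ℕ → Tm → Sb
  (x ↦ t) y with y ℕ.≟ x
  ... | yes _ = t
  ... | no _  = var y

  ↦-hit : ∀ x t → (x ↦ t) x ≡ t
  ↦-hit x t with x ℕ.≟ x
  ... | yes _  = refl
  ... | no x≢x = ⊥-elim (x≢x refl)

  ↦-miss : ∀ x t {y} → y ≢ x → (x ↦ t) y ≡ var y
  ↦-miss x t {y} y≢x with y ℕ.≟ x
  ... | yes y≡x = ⊥-elim (y≢x y≡x)
  ... | no _    = refl

  ↦-absorbed : ∀ {σ} x t → σ x ≡ sT σ t → (σ ∘ₛ (x ↦ t)) ≗ σ
  ↦-absorbed x t h y with y ℕ.≟ x
  ... | yes refl = sym h
  ... | no _     = refl

  ↦-fixes : ∀ x t → x ∉ varsT L T t → sT (x ↦ t) t ≡ t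
  ↦-fixes x t x∉t = trans (substT-local t (λ y∈t → ↦-miss x t (λ { refl → x∉t y∈t }))) (substT-id t)

  occurs-check : ∀ σ x t → t ≢ var x → x ∈ varsT L T t → σ x ≢ sT σ t
  occurs-check σ x (var y)    t≢x (here refl) _ = t≢x refl
  occurs-check σ x (fun f ts) _   x∈ts        e =
    ℕP.<-irrefl refl (ℕP.≤-<-trans (size-var≤ₛ σ ts x∈ts) (ℕP.≤-reflexive (sym (cong size e))))

  size-positive : ∀ t → 0 < size t
  size-positive (var _)   = s≤s z≤n
  size-positive (fun _ _) = s≤s z≤n

  tail-smaller : ∀ t {m n} → size t + m ≤ n → m < n
  tail-smaller t {m} bound = ℕP.<-≤-trans (ℕP.m<n+m m (size-positive t)) bound

  -- Recursion on the size of the σ-instances of the left-hand sides, for a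
  -- fixed solution σ: decomposition removes a function symbol, and after
  -- eliminating x ↦ t the measure of the remaining equations is unchanged
  -- because σ absorbs x ↦ t.
  MGUBelow : ℕ → Set
  MGUBelow n = ∀ σ E → Solves σ E → lhsSize σ E < n → HasMGU (λ θ → Solves θ E)

  mgu-eliminate : ∀ n → MGUBelow n → ∀ σ x t E → σ x ≡ sT σ t → Solves σ E →
                  size (σ x) + lhsSize σ E ≤ n → HasMGU (λ θ → Solves θ ((var x , t) ∷ E))
  mgu-eliminate n rec σ x t E σx≡σt σE bound with t ≟ₜ var x | x ∈? varsT L T t
  ... | yes refl | _ = HasMGU-resp (λ θ u → refl ∷ u) (λ { θ (_ ∷ u) → u }) (rec σ E σE (tail-smaller (σ x) bound))
  ... | no t≢x | yes x∈t = ⊥-elim (occurs-check σ x t t≢x x∈t σx≡σt)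
  ... | no _   | no x∉t  = θ , (θx≡θt ∷ Solves-substEqs⁻ E θ′E′) , general
    where
    η = x ↦ t
    E′ = substEqs η E
    smaller : lhsSize σ E′ < n
    smaller = subst (_< n) (sym (lhsSize-substEqs σ η (↦-absorbed x t σx≡σt) E))
                    (tail-smaller (σ x) bound)
    σE′ : Solves σ E′
    σE′ = Solves-substEqs⁺ E (Solves-cong (sym ∘ ↦-absorbed x t σx≡σt) E σE)
    mgu′ = rec σ E′ σE′ smaller
    θ′ = proj₁ mgu′
    θ′E′ = proj₁ (proj₂ mgu′)
    θ = θ′ ∘ₛ η
    θx≡θt : sT θ (var x) ≡ sT θ t
    θx≡θt = begin
      sT θ′ (η x)      ≡⟨ cong (sT θ′) (↦-hit x t) ⟩
      sT θ′ t          ≡⟨ cong (sT θ′) (sym (↦-fixes x t x∉t)) ⟩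
      sT θ′ (sT η t)   ≡⟨ substT-∘ t ⟩
      sT θ t           ∎
      where open ≡-Reasoning
    general : ∀ τ → Solves τ ((var x , t) ∷ E) → Σ Sb (λ δ → τ ≗ δ ∘ₛ θ)
    general τ (τx≡τt ∷ τE) = δ , factor
      where
      τ-absorbs = ↦-absorbed x t τx≡τt
      factorization = proj₂ (proj₂ mgu′) τ (Solves-substEqs⁺ E (Solves-cong (sym ∘ τ-absorbs) E τE))
      δ = proj₁ factorization
      factor : τ ≗ δ ∘ₛ θ
      factor y = trans (sym (τ-absorbs y)) (trans (substT-cong (proj₂ factorization) (η y)) (sym (substT-∘ (η y))))

  fun-head : ∀ {f g} {ts : Vec Tm (arity L T f)} {us : Vec Tm (arity L T g)} → fun f ts ≡ fun g us → f ≡ g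
  fun-head refl = refl

  mgu-below : ∀ n → MGUBelow n
  mgu-below zero    σ E                        _        ()
  mgu-below (suc n) σ []                       _        _ = var , [] , (λ τ _ → τ , (λ x → refl))
  mgu-below (suc n) σ ((var x , t) ∷ E)        (u ∷ us) (s≤s bound) =
    mgu-eliminate n (mgu-below n) σ x t E u us bound
  mgu-below (suc n) σ ((fun f ts , var x) ∷ E) (u ∷ us) (s≤s bound) =
    HasMGU-resp flip flip
      (mgu-eliminate n (mgu-below n) σ x (fun f ts) E (sym u) us (subst (λ k → k + lhsSize σ E ≤ n) (cong size u) bound))
    where
    flip : ∀ {s t} θ → Solves θ ((s , t) ∷ E) → Solves θ ((t , s) ∷ E)
    flip θ (v ∷ vs) = sym v ∷ vs
  mgu-below (suc n) σ ((fun f ts , fun g us) ∷ E) (u ∷ uE) (s≤s bound) with fun-head u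
  ... | refl = HasMGU-resp to from (mgu-below n σ (zipEqs ts us ++ E) σE′ smaller)
    where
    σE′ = AllP.++⁺ (Solves-zipEqs⁺ σ ts us (fun-injective u)) uE
    smaller = subst (_< n) (sym (trans (lhsSize-++ σ (zipEqs ts us) E) (cong (_+ lhsSize σ E) (lhsSize-zipEqs σ ts us)))) bound
    to : ∀ θ → Solves θ (zipEqs ts us ++ E) → Solves θ ((fun f ts , fun f us) ∷ E)
    to θ w = cong (fun f) (Solves-zipEqs⁻ θ ts us (AllP.++⁻ˡ _ w)) ∷ AllP.++⁻ʳ _ w
    from : ∀ θ → Solves θ ((fun f ts , fun f us) ∷ E) → Solves θ (zipEqs ts us ++ E)
    from θ (w ∷ ws) = AllP.++⁺ (Solves-zipEqs⁺ θ ts us (fun-injective w)) ws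

  mgu-terms : ∀ σ E → Solves σ E → HasMGU (λ θ → Solves θ E)
  mgu-terms σ E σE = mgu-below (suc (lhsSize σ E)) σ E σE ℕP.≤-refl

  qargsEq-as-termEqs : ∀ σ {n} (as bs : Vec QA n) → V.map (sQ σ) as ≡ V.map (sQ σ) bs →
                       Σ (List TermEq) (SameSolutions (λ θ → V.map (sQ θ) as ≡ V.map (sQ θ) bs))
  qargsEq-as-termEqs σ V.[] V.[] e = [] , (λ θ → (λ _ → []) , (λ _ → refl))
  qargsEq-as-termEqs σ (a V.∷ as) (b V.∷ bs) e with qargsEq-as-termEqs σ as bs (VecP.∷-injectiveʳ e)
  qargsEq-as-termEqs σ (⋆ V.∷ as) (⋆ V.∷ bs) e | E , same-E =
    E , (λ θ → (proj₁ (same-E θ) ∘ VecP.∷-injectiveʳ) , (cong (⋆ V.∷_) ∘ proj₂ (same-E θ)))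
  qargsEq-as-termEqs σ (tm s V.∷ as) (tm s′ V.∷ bs) e | E , same-E =
    (s , s′) ∷ E ,
    (λ θ → (λ w → tm-injective (VecP.∷-injectiveˡ w) ∷ proj₁ (same-E θ) (VecP.∷-injectiveʳ w)) ,
           (λ { (w ∷ ws) → cong₂ V._∷_ (cong tm w) (proj₂ (same-E θ) ws) }))
    where
    tm-injective : ∀ {a b : Tm} → QArg.tm a ≡ tm b → a ≡ b
    tm-injective refl = refl
  qargsEq-as-termEqs σ (⋆ V.∷ as) (tm _ V.∷ bs) e | _ with VecP.∷-injectiveˡ e
  ... | ()
  qargsEq-as-termEqs σ (tm _ V.∷ as) (⋆ V.∷ bs) e | _ with VecP.∷-injectiveˡ e
  ... | ()

  atom-head : ∀ {p p′} {ts : Vec Tm (pAr p)} {us : Vec Tm (pAr p′)} → at (atom p ts) ≡ at (atom p′ us) → p ≡ p′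
  atom-head refl = refl

  qa-head : ∀ {q q′ p p′} {as : Vec QA (pAr p)} {bs : Vec QA (pAr p′)} →
            qa q p as ≡ qa q′ p′ bs → q ≡ q′ × p ≡ p′
  qa-head refl = refl , refl

  atom-injective : ∀ {p} {ts us : Vec Tm (pAr p)} → at (atom p ts) ≡ at (atom p us) → ts ≡ us
  atom-injective refl = refl

  qa-injective : ∀ {q p} {as bs : Vec QA (pAr p)} → qa q p as ≡ qa q p bs → as ≡ bs
  qa-injective refl = refl

  exprEq-as-termEqs : ∀ σ (a b : Ex) → sE σ a ≡ sE σ b →
                      Σ (List TermEq) (SameSolutions (λ θ → sE θ a ≡ sE θ b))
  exprEq-as-termEqs σ (at (atom p ts)) (at (atom p′ us)) e with atom-head e
  ... | refl = zipEqs ts us ,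
               (λ θ → (Solves-zipEqs⁺ θ ts us ∘ atom-injective) , (cong (at ∘ atom p) ∘ Solves-zipEqs⁻ θ ts us))
  exprEq-as-termEqs σ (tc c) (tc d) refl = [] , (λ θ → (λ _ → []) , (λ _ → refl))
  exprEq-as-termEqs σ (qa q p as) (qa q′ p′ bs) e with qa-head e
  ... | refl , refl with qargsEq-as-termEqs σ as bs (qa-injective e)
  ...   | E , same-E = E , (λ θ → (proj₁ (same-E θ) ∘ qa-injective) , (cong (qa q p) ∘ proj₂ (same-E θ)))
  exprEq-as-termEqs σ (at (atom _ _)) (tc _)          ()
  exprEq-as-termEqs σ (at (atom _ _)) (qa _ _ _)      ()
  exprEq-as-termEqs σ (tc _)          (at (atom _ _)) ()
  exprEq-as-termEqs σ (tc _)          (qa _ _ _)      ()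
  exprEq-as-termEqs σ (qa _ _ _)      (at (atom _ _)) ()
  exprEq-as-termEqs σ (qa _ _ _)      (tc _)          ()

  exprEqs-as-termEqs : ∀ σ eqs → Unifies L T σ eqs → Σ (List TermEq) (SameSolutions (λ θ → Unifies L T θ eqs))
  exprEqs-as-termEqs σ []              []       = [] , (λ θ → (λ _ → []) , (λ _ → []))
  exprEqs-as-termEqs σ ((a , b) ∷ eqs) (u ∷ us)
    with exprEq-as-termEqs σ a b u | exprEqs-as-termEqs σ eqs us
  ... | E₁ , same₁ | E₂ , same₂ =
    E₁ ++ E₂ ,
    (λ θ → (λ { (w ∷ ws) → AllP.++⁺ (proj₁ (same₁ θ) w) (proj₁ (same₂ θ) ws) }) ,
           (λ w → proj₂ (same₁ θ) (AllP.++⁻ˡ E₁ w) ∷ proj₂ (same₂ θ) (AllP.++⁻ʳ E₁ w)))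

  mgu-exists : ∀ σ eqs → Unifies L T σ eqs → Σ Sb (λ θ → IsMGU L T θ eqs)
  mgu-exists σ eqs σeqs with exprEqs-as-termEqs σ eqs σeqs
  ... | E , agree = HasMGU-resp (proj₂ ∘ agree) (proj₁ ∘ agree) (mgu-terms σ E (proj₁ (agree σ) σeqs))

  -- Renaming apart

  even odd : ℕ → ℕ
  even zero    = zero
  even (suc n) = suc (suc (even n))
  odd n = suc (even n)

  parity : ℕ → ℕ ⊎ ℕ
  parity zero          = inj₁ zero
  parity (suc zero)    = inj₂ zero
  parity (suc (suc n)) with parity n
  ... | inj₁ m = inj₁ (suc m)
  ... | inj₂ m = inj₂ (suc m)

  parity-even : ∀ n → parity (even n) ≡ inj₁ n
  parity-even zero    = refl
  parity-even (suc n) rewrite parity-even n = refl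

  parity-odd : ∀ n → parity (odd n) ≡ inj₂ n
  parity-odd zero    = refl
  parity-odd (suc n) rewrite parity-odd n = refl

  even-injective : Injective L T even
  even-injective {x} {y} e with trans (sym (parity-even x)) (trans (cong parity e) (parity-even y))
  ... | refl = refl

  odd-injective : Injective L T odd
  odd-injective {x} {y} e with trans (sym (parity-odd x)) (trans (cong parity e) (parity-odd y))
  ... | refl = refl

  even≢odd : ∀ m n → even m ≢ odd n
  even≢odd m n e with trans (sym (parity-even m)) (trans (cong parity e) (parity-odd n))
  ... | ()

  merge : Sb → Sb → Sb
  merge σ τ y with parity y
  ... | inj₁ m = σ m
  ... | inj₂ m = τ m

  merge-even : ∀ σ τ → (merge σ τ ∘ even) ≗ σ
  merge-even σ τ y rewrite parity-even y = refl

  merge-odd : ∀ σ τ → (merge σ τ ∘ odd) ≗ τ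
  merge-odd σ τ y rewrite parity-odd y = refl

  injective-∘ : ∀ {π π′ : ℕ → ℕ} → Injective L T π → Injective L T π′ → Injective L T (π ∘ π′)
  injective-∘ π-inj π′-inj e = π′-inj (π-inj e)

  InImage : (ℕ → ℕ) → ℕ → Set
  InImage π x = Σ ℕ (λ y → x ≡ π y)

  InImage-∘ : ∀ {π π′ : ℕ → ℕ} {xs} → All (InImage (π ∘ π′)) xs → All (InImage π) xs
  InImage-∘ {π′ = π′} = All.map (λ (y , e) → π′ y , e)

  disjoint-images : ∀ {π : ℕ → ℕ} → Injective L T π → ∀ {xs ys} →
                    All (InImage (π ∘ even)) xs → All (InImage (π ∘ odd)) ys → DisjointV L T xs ys
  disjoint-images π-inj xs-even ys-odd x∈xs x∈ys with All.lookup xs-even x∈xs | All.lookup ys-odd x∈ys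
  ... | m , refl | n , e = even≢odd m n (π-inj e)

  evens-odds-disjoint : ∀ {xs ys} → All (InImage even) xs → All (InImage odd) ys → DisjointV L T xs ys
  evens-odds-disjoint = disjoint-images {π = λ x → x} (λ e → e)

  mutual
    vars-renameT : ∀ π t → All (InImage π) (varsT L T (sT (rename π) t))
    vars-renameT π (var x)    = (x , refl) ∷ []
    vars-renameT π (fun f ts) = vars-renameTs π ts

    vars-renameTs : ∀ π {n} (ts : Vec Tm n) → All (InImage π) (varsTs L T (sTs (rename π) ts))
    vars-renameTs π V.[]       = []
    vars-renameTs π (t V.∷ ts) = AllP.++⁺ (vars-renameT π t) (vars-renameTs π ts)

  vars-renameQs : ∀ π {n} (as : Vec QA n) → All (InImage π) (varsQs L T (V.map (sQ (rename π)) as))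
  vars-renameQs π V.[]          = []
  vars-renameQs π (⋆ V.∷ as)    = vars-renameQs π as
  vars-renameQs π (tm t V.∷ as) = AllP.++⁺ (vars-renameT π t) (vars-renameQs π as)

  vars-renameE : ∀ π e → All (InImage π) (varsE L T (sE (rename π) e))
  vars-renameE π (at (atom p ts)) = vars-renameTs π ts
  vars-renameE π (tc c)           = []
  vars-renameE π (qa q p as)      = vars-renameQs π as

  vars-renameC : ∀ π C → All (InImage π) (varsC L T (sC (rename π) C))
  vars-renameC π []              = []
  vars-renameC π (lit a r b ∷ C) = AllP.++⁺ (AllP.++⁺ (vars-renameE π a) (vars-renameE π b)) (vars-renameC π C)

  varsLit : Lt → List ℕ
  varsLit l = varsE L T (lhs L T l) ++ varsE L T (rhs L T l)

  All-varsLit-≈ₗ : ∀ {P : ℕ → Set} {l m} → l ≈ₗ m → All P (varsLit m) → All P (varsLit l)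
  All-varsLit-≈ₗ same p = p
  All-varsLit-≈ₗ {m = lit a _ b} swap p = let (pa , pb) = AllP.++⁻ (varsE L T a) p in AllP.++⁺ pb pa

  All-varsC-∈ₗ : ∀ {P : ℕ → Set} {l} R → l ∈ₗ R → All P (varsC L T R) → All P (varsLit l)
  All-varsC-∈ₗ (m ∷ R) (here e)  p = All-varsLit-≈ₗ e (AllP.++⁻ˡ (varsLit m) p)
  All-varsC-∈ₗ (m ∷ R) (there x) p = All-varsC-∈ₗ R x (AllP.++⁻ʳ (varsLit m) p)

  All-varsC-⊆ₗ : ∀ {P : ℕ → Set} R D → D ⊆ₗ R → All P (varsC L T R) → All P (varsC L T D)
  All-varsC-⊆ₗ R []      []       p = []
  All-varsC-⊆ₗ R (l ∷ D) (m ∷ ms) p = AllP.++⁺ (All-varsC-∈ₗ R m p) (All-varsC-⊆ₗ R D ms p)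

  Lifts : List Cl → List Cl → Set
  Lifts = Pointwise (InstanceOf L T)

  InstanceOfSome : List Cl → Cl → Set
  InstanceOfSome Cs* C = Σ Cl (λ C* → C* ∈ Cs* × InstanceOf L T C C*)

  instanceOfSome : ∀ {Cs Cs* C} → Lifts Cs Cs* → _∈C_ L T C Cs → InstanceOfSome Cs* C
  instanceOfSome ((ϑ , D≈) ∷ _) (here C≈D) = _ , here refl , ϑ , ≈c-trans C≈D D≈
  instanceOfSome (_ ∷ lifts) (there C∈) with instanceOfSome lifts C∈
  ... | C* , C*∈ , inst = C* , there C*∈ , inst

  occursIn-subst : ∀ σ {e} C → e occurs-in C → sE σ e occurs-in sC σ C
  occursIn-subst σ (lit a r b ∷ C) (here (inj₁ refl)) = here (inj₁ refl)
  occursIn-subst σ (lit a r b ∷ C) (here (inj₂ refl)) = here (inj₂ refl)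
  occursIn-subst σ (_ ∷ C)         (there o)          = there (occursIn-subst σ C o)

  InstanceOccurs : List Cl → Ex → Set
  InstanceOccurs Cs* e = Σ Cl (λ C* → C* ∈ Cs* × Σ Sb (λ ϑ → Σ Ex (λ e* → e* occurs-in C* × sE ϑ e* ≡ e)))

  occursIn-instance : ∀ {e C} ϑ D → e occurs-in C → C ⊆ₗ sC ϑ D → Σ Ex (λ e* → e* occurs-in D × sE ϑ e* ≡ e)
  occursIn-instance ϑ D (here e∈l) (l∈ ∷ _) = side e∈l (∈ₗ-subst⁻ ϑ D l∈)
    where
    side : ∀ {e l} → (e ≡ lhs L T l ⊎ e ≡ rhs L T l) → Σ Lt (λ m → m ∈ D × l ≈ₗ sL ϑ m) →
           Σ Ex (λ e* → e* occurs-in D × sE ϑ e* ≡ e)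
    side (inj₁ refl) (lit a r b , m∈ , same) = a , Any.map (λ { refl → inj₁ refl }) m∈ , refl
    side (inj₂ refl) (lit a r b , m∈ , same) = b , Any.map (λ { refl → inj₂ refl }) m∈ , refl
    side (inj₁ refl) (lit a r b , m∈ , swap) = b , Any.map (λ { refl → inj₂ refl }) m∈ , refl
    side (inj₂ refl) (lit a r b , m∈ , swap) = a , Any.map (λ { refl → inj₁ refl }) m∈ , refl
  occursIn-instance ϑ D (there o) (_ ∷ C⊆) = occursIn-instance ϑ D o C⊆

  instanceOccurs : ∀ {Cs Cs* e} → Lifts Cs Cs* → _occursInS_ L T e Cs → InstanceOccurs Cs* e
  instanceOccurs (_∷_ {y = C*} (ϑ , C⊆ , _) _) (here o) with occursIn-instance ϑ C* o C⊆
  ... | e* , o* , e*↦e = C* , here refl , ϑ , e* , o* , e*↦e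
  instanceOccurs (_ ∷ lifts) (there o) with instanceOccurs lifts o
  ... | C* , C*∈ , found = C* , there C*∈ , found

  record RenamedOccurrence (Cs* : List Cl) (π : ℕ → ℕ) (e : Ex) : Set where
    field
      source    : Cl
      source∈   : source ∈ Cs*
      ϑ         : Sb
      e*        : Ex
      e*-occurs : e* occurs-in source
      e*↦e      : sE ϑ e* ≡ e

    clause : Cl
    clause = sC (rename π) source

    expr : Ex
    expr = sE (rename π) e*

    expr-occurs : expr occurs-in clause
    expr-occurs = occursIn-subst (rename π) source e*-occurs

    expr↦e : ∀ σ → (σ ∘ π) ≗ ϑ → sE σ expr ≡ e
    expr↦e σ σπ≗ϑ = trans (substE-∘ e*) (trans (substE-cong σπ≗ϑ e*) e*↦e)

  renameOccurrence : ∀ {Cs* e} π → InstanceOccurs Cs* e → RenamedOccurrence Cs* π e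
  renameOccurrence π (C* , C*∈ , ϑ , e* , o , e*↦e) =
    record { source = C* ; source∈ = C*∈ ; ϑ = ϑ ; e* = e* ; e*-occurs = o ; e*↦e = e*↦e }

  renaming-variant : ∀ {π C* Cs* D} → Injective L T π → C* ∈ Cs* → D ≈c sC (rename π) C* → InVrnt L T Cs* D
  renaming-variant {π} π-inj C*∈ D≈ = Any.map (λ { refl → π , (λ {x} {y} → π-inj {x} {y}) , D≈ }) C*∈

  renamed-occursInVrnt : ∀ {Cs* e π} → Injective L T π → (r : RenamedOccurrence Cs* π e) →
                         _occursInVrnt_ L T (RenamedOccurrence.expr r) Cs*
  renamed-occursInVrnt π-inj r = clause , renaming-variant π-inj source∈ ≈c-refl , expr-occurs
    where open RenamedOccurrence r

  isAtom-subst⁻ : ∀ σ e → isAtom L T (sE σ e) → isAtom L T e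
  isAtom-subst⁻ σ (at _) _ = tt

  isTC-subst : ∀ σ e → isTC L T e → isTC L T (sE σ e)
  isTC-subst σ (tc _) _ = tt

  tc-subst⁻ : ∀ σ e {c} → sE σ e ≡ tc c → e ≡ tc c
  tc-subst⁻ σ (at (atom _ _)) ()
  tc-subst⁻ σ (tc _)          refl = refl
  tc-subst⁻ σ (qa _ _ _)      ()

  InnerTC-subst⁻ : ∀ σ e → InnerTC L T (sE σ e) → InnerTC L T e
  InnerTC-subst⁻ σ e (c , σe≡c , c≢0 , c≢1) = c , tc-subst⁻ σ e σe≡c , c≢0 , c≢1

  qa-subst⁻ : ∀ σ e {q p as} → sE σ e ≡ qa q p as →
              Σ (Vec QA (pAr p)) (λ as* → e ≡ qa q p as* × V.map (sQ σ) as* ≡ as)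
  qa-subst⁻ σ (at (atom _ _)) ()
  qa-subst⁻ σ (tc _)          ()
  qa-subst⁻ σ (qa q p as*)    e with qa-head e
  ... | refl , refl = as* , refl , qa-injective e

  qClause-subst : ∀ σ q e a → sC σ (qClause L T q e a) ≡ qClause L T q (sE σ e) (sE σ a)
  qClause-subst σ ∀q e a = refl
  qClause-subst σ ∃q e a = refl

  wClause-subst : ∀ σ q e a b → sC σ (wClause L T q e a b) ≡ wClause L T q (sE σ e) (sE σ a) (sE σ b)
  wClause-subst σ ∀q e a b = refl
  wClause-subst σ ∃q e a b = refl

  instArgs-subst : ∀ σ {n} (as : Vec QA n) u → sTs σ (instArgs L T as u) ≡ instArgs L T (V.map (sQ σ) as) (sT σ u)
  instArgs-subst σ V.[]          u = refl
  instArgs-subst σ (⋆ V.∷ as)    u = cong (_ V.∷_) (instArgs-subst σ as u)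
  instArgs-subst σ (tm s V.∷ as) u = cong (_ V.∷_) (instArgs-subst σ as u)

  freetermseq-subst : ∀ σ e → freetermseq L T (sE σ e) ≡ map (sT σ) (freetermseq L T e)
  freetermseq-subst σ (at (atom p ts)) = toList-subst ts
    where
    toList-subst : ∀ {n} (ts : Vec Tm n) → toList (sTs σ ts) ≡ map (sT σ) (toList ts)
    toList-subst V.[]       = refl
    toList-subst (t V.∷ ts) = cong (_ ∷_) (toList-subst ts)
  freetermseq-subst σ (tc c)           = refl
  freetermseq-subst σ (qa q p as)      = ftsQ-subst as
    where
    ftsQ-subst : ∀ {n} (as : Vec QA n) → ftsQ L T (V.map (sQ σ) as) ≡ map (sT σ) (ftsQ L T as)
    ftsQ-subst V.[]          = refl
    ftsQ-subst (⋆ V.∷ as)    = ftsQ-subst as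
    ftsQ-subst (tm t V.∷ as) = cong (_ ∷_) (ftsQ-subst as)

  freetermseqs-subst : ∀ σ e b → freetermseq L T (sE σ e) ++ freetermseq L T (sE σ b) ≡
                                 map (sT σ) (freetermseq L T e ++ freetermseq L T b)
  freetermseqs-subst σ e b =
    trans (cong₂ _++_ (freetermseq-subst σ e) (freetermseq-subst σ b))
          (sym (ListP.map-++ (sT σ) (freetermseq L T e) (freetermseq L T b)))

  w-arity-subst : ∀ σ e b → w-arity L T (sE σ e) (sE σ b) ≡ w-arity L T e b
  w-arity-subst σ e b =
    trans (cong length (freetermseqs-subst σ e b)) (ListP.length-map (sT σ) (freetermseq L T e ++ freetermseq L T b))

  w-term-subst : ∀ σ e b k → sT σ (w-term L T e b k) ≡ w-term L T (sE σ e) (sE σ b) k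
  w-term-subst σ e b k = trans (cong applyFresh (sym (fromList-subst (freetermseq L T e ++ freetermseq L T b))))
                               (cong (λ us → applyFresh (length us , fromList us)) (sym (freetermseqs-subst σ e b)))
    where
    applyFresh : Σ ℕ (Vec Tm) → Tm
    applyFresh (n , us) = fun (fresh n k) us
    fromList-subst : ∀ (us : List Tm) → _≡_ {A = Σ ℕ (Vec Tm)}
                     (length (map (sT σ) us) , fromList (map (sT σ) us)) (length us , sTs σ (fromList us))
    fromList-subst []       = refl
    fromList-subst (u ∷ us) = cong (λ (n , vs) → suc n , sT σ u V.∷ vs) (fromList-subst us)

  LiftedStep : ClauseSet L T → List (ℕ × ℕ) → List Cl → Cl → List (ℕ × ℕ) → Set
  LiftedStep S Λ Cs* C Λ′ = Σ Cl (λ C* → HStep L T S Λ Cs* C* Λ′ × InstanceOf L T C C*)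

  record RenamedApart (Cs* : List Cl) (a b : Ex) : Set where
    field
      a′ b′     : Ex
      σ         : Sb
      a′-occurs : _occursInVrnt_ L T a′ Cs*
      b′-occurs : _occursInVrnt_ L T b′ Cs*
      disjoint  : DisjointV L T (varsE L T a′) (varsE L T b′)
      a′↦a      : sE σ a′ ≡ a
      b′↦b      : sE σ b′ ≡ b

  renameApart : ∀ {Cs Cs* a b} → Lifts Cs Cs* →
                _occursInS_ L T a Cs → _occursInS_ L T b Cs → RenamedApart Cs* a b
  renameApart lifts a-occ b-occ = record
    { a′ = expr ra ; b′ = expr rb ; σ = σ
    ; a′-occurs = renamed-occursInVrnt even-injective ra
    ; b′-occurs = renamed-occursInVrnt odd-injective rb
    ; disjoint  = evens-odds-disjoint (vars-renameE even (e* ra)) (vars-renameE odd (e* rb))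
    ; a′↦a = expr↦e ra σ (merge-even _ _)
    ; b′↦b = expr↦e rb σ (merge-odd _ _) }
    where
    open RenamedOccurrence
    ra = renameOccurrence even (instanceOccurs lifts a-occ)
    rb = renameOccurrence odd (instanceOccurs lifts b-occ)
    σ = merge (ϑ ra) (ϑ rb)

  atomOrInner-subst⁻ : ∀ σ e′ {e} → sE σ e′ ≡ e →
                       (isAtom L T e ⊎ InnerTC L T e) → (isAtom L T e′ ⊎ InnerTC L T e′)
  atomOrInner-subst⁻ σ e′ refl (inj₁ e-atom) = inj₁ (isAtom-subst⁻ σ e′ e-atom)
  atomOrInner-subst⁻ σ e′ refl (inj₂ e-inner) = inj₂ (InnerTC-subst⁻ σ e′ e-inner)

  lift-b2-noQ : ∀ {S Λ Cs Cs* C} → Lifts Cs Cs* → (a b : Ex) → NoQ L T S →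
                isAtom L T a → _occursInS_ L T a Cs → InnerTC L T b → _occursInS_ L T b Cs →
                C ≈c triClause L T a b → LiftedStep S Λ Cs* C Λ
  lift-b2-noQ lifts a b noQ a-atom a-occ b-inner b-occ C≈ =
    triClause L T a′ b′ ,
    g2-noQ a′ b′ noQ (isAtom-subst⁻ σ a′ (subst (isAtom L T) (sym a′↦a) a-atom)) a′-occurs
                     (InnerTC-subst⁻ σ b′ (subst (InnerTC L T) (sym b′↦b) b-inner)) b′-occurs ≈c-refl ,
    ≈c-instance σ (triClause L T a′ b′) C≈ (cong₂ (triClause L T) a′↦a b′↦b)
    where open RenamedApart (renameApart lifts a-occ b-occ)

  lift-b2-Q : ∀ {S Λ Cs Cs* C} → Lifts Cs Cs* → (a b : Ex) → HasQ L T S →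
              (isAtom L T a ⊎ InnerTC L T a) → _occursInS_ L T a Cs →
              (isAtom L T b ⊎ InnerTC L T b) → _occursInS_ L T b Cs →
              ¬ (isTC L T a × isTC L T b) → C ≈c triClause L T a b → LiftedStep S Λ Cs* C Λ
  lift-b2-Q lifts a b hasQ a-shape a-occ b-shape b-occ not-both-tc C≈ =
    triClause L T a′ b′ ,
    g2-Q a′ b′ hasQ (atomOrInner-subst⁻ σ a′ a′↦a a-shape) a′-occurs
                    (atomOrInner-subst⁻ σ b′ b′↦b b-shape) b′-occurs
         (λ (a′-tc , b′-tc) → not-both-tc (subst (isTC L T) a′↦a (isTC-subst σ a′ a′-tc) ,
                                            subst (isTC L T) b′↦b (isTC-subst σ b′ b′-tc)))
         disjoint ≈c-refl ,
    ≈c-instance σ (triClause L T a′ b′) C≈ (cong₂ (triClause L T) a′↦a b′↦b)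
    where open RenamedApart (renameApart lifts a-occ b-occ)

  record RenamedQAtom (Cs* : List Cl) (π : ℕ → ℕ) (q : Quant L T) (p : Pred) (as : Vec QA (pAr p)) : Set where
    field
      occurrence : RenamedOccurrence Cs* π (qa q p as)
      as′        : Vec QA (pAr p)
      shape      : RenamedOccurrence.expr occurrence ≡ qa q p as′

    open RenamedOccurrence occurrence public

    as′↦as : ∀ σ → (σ ∘ π) ≗ ϑ → V.map (sQ σ) as′ ≡ as
    as′↦as σ σπ≗ϑ = qa-injective (trans (cong (sE σ) (sym shape)) (expr↦e σ σπ≗ϑ))

    as′-occurs : qa q p as′ occurs-in clause
    as′-occurs = subst (_occurs-in clause) shape expr-occurs

    as′-vars : All (InImage π) (varsE L T (qa q p as′))
    as′-vars = subst (All (InImage π) ∘ varsE L T) shape (vars-renameE π e*)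

  renameQAtom : ∀ {Cs* q p as} π → InstanceOccurs Cs* (qa q p as) → RenamedQAtom Cs* π q p as
  renameQAtom π found with renameOccurrence π found
  ... | r with qa-subst⁻ (RenamedOccurrence.ϑ r) (RenamedOccurrence.e* r) (RenamedOccurrence.e*↦e r)
  ...   | as* , refl , _ = record { occurrence = r ; as′ = V.map (sQ (rename π)) as* ; shape = refl }

  odd-not-even : ∀ {xs} → All (InImage even) xs → odd 0 ∉ xs
  odd-not-even xs-even x∈xs with All.lookup xs-even x∈xs
  ... | y , e = even≢odd y 0 (sym e)

  lift-b3 : ∀ {S Λ Cs Cs* C} → Lifts Cs Cs* → (q : Quant L T) (p : Pred) (as : Vec QA (pAr p)) (t : Tm) →
            _occursInS_ L T (qa q p as) Cs →
            C ≈c qClause L T q (qa q p as) (at (atom p (instArgs L T as t))) → LiftedStep S Λ Cs* C Λ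
  lift-b3 lifts q p as t qa-occ C≈ =
    C* , g3 q p as′ x (clause , renaming-variant even-injective source∈ ≈c-refl , as′-occurs)
                      (odd-not-even as′-vars) ≈c-refl ,
    ≈c-instance σ C* C≈ (trans (qClause-subst σ q _ _)
      (cong₂ (λ bs u → qClause L T q (qa q p bs) (at (atom p u))) σas′≡as
             (trans (instArgs-subst σ as′ (var x)) (cong₂ (instArgs L T) σas′≡as (merge-odd ϑ (λ _ → t) 0)))))
    where
    open RenamedQAtom (renameQAtom even (instanceOccurs lifts qa-occ))
    -- the renamed quantified atom has only even variables, so x is new; σ sends it to t
    x = odd 0
    C* = qClause L T q (qa q p as′) (at (atom p (instArgs L T as′ (var x))))
    σ = merge ϑ (λ _ → t)
    σas′≡as = as′↦as σ (merge-even _ _)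

  lift-b4 : ∀ {S Λ Cs Cs* C} → Lifts Cs Cs* →
            (q : Quant L T) (p : Pred) (as : Vec QA (pAr p)) (b : Ex) (k : ℕ) →
            _occursInS_ L T (qa q p as) Cs → _occursInS_ L T b Cs →
            (w-arity L T (qa q p as) b , k) ∉ Λ →
            C ≈c wClause L T q (qa q p as) (at (atom p (instArgs L T as (w-term L T (qa q p as) b k)))) b →
            LiftedStep S Λ Cs* C ((w-arity L T (qa q p as) b , k) ∷ Λ)
  lift-b4 {S} {Λ} {Cs* = Cs*} lifts q p as b k qa-occ b-occ w-new C≈ =
    C* , subst (λ n → HStep L T S Λ Cs* C* ((n , k) ∷ Λ)) same-arity
               (g4 q p as′ b′ clause B.clause k
                   (renaming-variant even-injective source∈ ≈c-refl) (renaming-variant odd-injective B.source∈ ≈c-refl)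
                   (evens-odds-disjoint (vars-renameC even source) (vars-renameC odd B.source))
                   as′-occurs B.expr-occurs (subst (λ n → (n , k) ∉ Λ) (sym same-arity) w-new) ≈c-refl) ,
    ≈c-instance σ C* C≈
      (trans (wClause-subst σ q qa′ _ b′)
        (trans (cong₂ (λ e v → wClause L T q e (at (atom p (sTs σ (instArgs L T as′ w′)))) v) σqa′≡qa σb′≡b)
               (cong (λ u → wClause L T q (qa q p as) (at (atom p u)) b) σinst≡inst)))
    where
    open RenamedQAtom (renameQAtom even (instanceOccurs lifts qa-occ))
    module B = RenamedOccurrence (renameOccurrence odd (instanceOccurs lifts b-occ))
    qa′ = qa q p as′
    b′ = B.expr
    w′ = w-term L T qa′ b′ k
    C* = wClause L T q qa′ (at (atom p (instArgs L T as′ w′))) b′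
    σ = merge ϑ B.ϑ
    σas′≡as = as′↦as σ (merge-even _ _)
    σqa′≡qa : sE σ qa′ ≡ qa q p as
    σqa′≡qa = cong (qa q p) σas′≡as
    σb′≡b = B.expr↦e σ (merge-odd _ _)
    σinst≡inst : sTs σ (instArgs L T as′ w′) ≡ instArgs L T as (w-term L T (qa q p as) b k)
    σinst≡inst = trans (instArgs-subst σ as′ w′)
                       (cong₂ (instArgs L T) σas′≡as
                              (trans (w-term-subst σ qa′ b′ k) (cong₂ (λ u v → w-term L T u v k) σqa′≡qa σb′≡b)))
    same-arity : w-arity L T qa′ b′ ≡ w-arity L T (qa q p as) b
    same-arity = trans (sym (w-arity-subst σ qa′ b′)) (cong₂ (w-arity L T) σqa′≡qa σb′≡b)

  -- Lifting hyperresolution chains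

  linkClause : LinkT → Cl
  linkClause j = linkLit L T j ∷ Link.rest j

  record Collapses (σ : Sb) (P : GPrem L T) (j : LinkT) : Set where
    field
      rel≡      : GPrem.rel P ≡ Link.rel j
      ε₀↦left   : sE σ (GPrem.ε₀ P) ≡ Link.left j
      υ₀↦right  : sE σ (GPrem.υ₀ P) ≡ Link.right j
      grouped   : Unifies L T σ (groupEqs L T P)
      rest↦rest : sC σ (GPrem.rest P) ≈c Link.rest j

  module PremiseLifting (σ : Sb) (j : LinkT) where
    open Link j

    asLit : Ex × Ex → Lt
    asLit (ε , υ) = lit ε rel υ

    Matches : Ex × Ex → Set
    Matches (ε , υ) = sE σ ε ≡ left × sE σ υ ≡ right

    orient : ∀ l → sL σ l ≈ₗ linkLit L T j → Σ (Ex × Ex) (λ eu → Matches eu × asLit eu ≈ₗ l)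
    orient (lit a r b) same = (a , b) , (refl , refl) , same
    orient (lit a r b) swap = (b , a) , (refl , refl) , swap

    -- A literal of the lifted premise is mapped by σ onto the chain literal (then it
    -- is grouped with it by (G1)) or onto a side literal; if both, it stays a side literal.
    record Split (R : Cl) : Set where
      field
        matching        : List (Ex × Ex)
        others          : Cl
        matching-sound  : All (λ eu → Matches eu × asLit eu ∈ₗ R) matching
        others-sound    : others ⊆ₗ R
        others-in-rest  : All (λ l → sL σ l ∈ₗ rest) others
        complete        : All (λ l → l ∈ₗ map asLit matching ⊎ l ∈ₗ others) R
        others-complete : All (λ l → sL σ l ∈ₗ rest → l ∈ₗ others) R

    split : ∀ R → All (λ l → sL σ l ∈ₗ linkClause j) R → Split R
    split []      []              = record
      { matching = [] ; others = [] ; matching-sound = [] ; others-sound = [] ; others-in-rest = []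
      ; complete = [] ; others-complete = [] }
    split (l ∷ R) (l∈ ∷ R∈) with split R R∈ | sL σ l ∈ₗ? rest
    ... | s | yes l∈rest = record
      { matching        = matching
      ; others          = l ∷ others
      ; matching-sound  = All.map (λ (m , x) → m , there x) matching-sound
      ; others-sound    = here same ∷ All.map there others-sound
      ; others-in-rest  = l∈rest ∷ others-in-rest
      ; complete        = inj₂ (here same) ∷ All.map [ inj₁ , inj₂ ∘ there ]′ complete
      ; others-complete = (λ _ → here same) ∷ All.map (there ∘_) others-complete }
      where open Split s
    ... | s | no l∉rest with l∈
    ...   | there l∈rest = ⊥-elim (l∉rest l∈rest)
    ...   | here l≈head with orient l l≈head
    ...     | eu , matches , eu≈l = record
      { matching        = eu ∷ matching
      ; others          = others
      ; matching-sound  = (matches , here eu≈l) ∷ All.map (λ (m , x) → m , there x) matching-sound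
      ; others-sound    = All.map there others-sound
      ; others-in-rest  = others-in-rest
      ; complete        = inj₁ (here (≈ₗ-sym eu≈l)) ∷ All.map [ inj₁ ∘ there , inj₂ ]′ complete
      ; others-complete = (λ l∈rest → ⊥-elim (l∉rest l∈rest)) ∷ others-complete }
      where open Split s

    liftPremise : ∀ R → linkClause j ≈c sC σ R → Σ (GPrem L T) (λ P → gClause L T P ≈c R × Collapses σ P j)
    liftPremise R (j⊆σR , σR⊆j) =
      P , (gP⊆R , R⊆gP) ,
      record { rel≡ = refl ; ε₀↦left = ε₀↦ ; υ₀↦right = υ₀↦ ; grouped = grouped matching-sound
             ; rest↦rest = AllP.map⁺ others-in-rest , All.map rest⊆σothers (All.zip (⊆ₗ-refl rest , All.tail j⊆σR)) }
      where
      head-source = ∈ₗ-subst⁻ σ R (All.head j⊆σR)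
      l₀ = proj₁ head-source
      oriented = orient l₀ (≈ₗ-sym (proj₂ (proj₂ head-source)))
      ε₀ = proj₁ (proj₁ oriented)
      υ₀ = proj₂ (proj₁ oriented)
      ε₀↦ = proj₁ (proj₁ (proj₂ oriented))
      υ₀↦ = proj₂ (proj₁ (proj₂ oriented))
      open Split (split R (AllP.map⁻ σR⊆j))
      P = mkGPrem rel ε₀ υ₀ matching others
      gP⊆R : gClause L T P ⊆ₗ R
      gP⊆R = ∈ₗ-resp-≈ₗ (proj₂ (proj₂ oriented)) (∈⇒∈ₗ (proj₁ (proj₂ head-source))) ∷
             AllP.++⁺ (AllP.map⁺ (All.map proj₂ matching-sound)) others-sound
      R⊆gP : R ⊆ₗ gClause L T P
      R⊆gP = All.map (there ∘ [ AnyP.++⁺ˡ , AnyP.++⁺ʳ (map asLit matching) ]′) complete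
      grouped : ∀ {X} → All (λ eu → Matches eu × asLit eu ∈ₗ R) X →
                Unifies L T σ (concatMap (λ eu → (proj₁ eu , ε₀) ∷ (proj₂ eu , υ₀) ∷ []) X)
      grouped []                           = []
      grouped (((ε↦ , υ↦) , _) ∷ matches) = trans ε↦ (sym ε₀↦) ∷ trans υ↦ (sym υ₀↦) ∷ grouped matches
      rest⊆σothers : ∀ {m} → m ∈ₗ rest × m ∈ₗ sC σ R → m ∈ₗ sC σ others
      rest⊆σothers (m∈rest , m∈σR) with ∈ₗ-subst⁻ σ R m∈σR
      ... | l , l∈R , m≈σl = ∈ₗ-resp-≈ₗ m≈σl (∈ₗ-subst σ (All.lookup others-complete l∈R σl∈rest))
        where
        σl∈rest = ∈ₗ-resp-≈ₗ (≈ₗ-sym m≈σl) m∈rest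

  chainSubst : ∀ {Cs* ls} → All (InstanceOfSome Cs* ∘ linkClause) ls → Sb
  chainSubst []                      = var
  chainSubst ((_ , _ , ϑ , _) ∷ ws) = merge ϑ (chainSubst ws)

  VarDisjoint : GPrem L T → GPrem L T → Set
  VarDisjoint P P′ = DisjointV L T (varsC L T (gClause L T P)) (varsC L T (gClause L T P′))

  module ChainLifting (σ : Sb) (Cs* : List Cl) where

    record LiftedChain (ls : List LinkT) (π : ℕ → ℕ) : Set where
      field
        premises  : List (GPrem L T)
        collapses : Pointwise (Collapses σ) premises ls
        variants  : All (λ P → InVrnt L T Cs* (gClause L T P)) premises
        vars-in-π : All (λ P → All (InImage π) (varsC L T (gClause L T P))) premises
        apart     : AllPairs VarDisjoint premises

    liftChain : ∀ ls (ws : All (InstanceOfSome Cs* ∘ linkClause) ls) π → Injective L T π →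
                (σ ∘ π) ≗ chainSubst ws → LiftedChain ls π
    liftChain [] [] π π-inj σπ≗ = record { premises = [] ; collapses = [] ; variants = [] ; vars-in-π = [] ; apart = [] }
    liftChain (j ∷ ls) ((C* , C*∈ , ϑ , j≈ϑC*) ∷ ws) π π-inj σπ≗ = record
      { premises  = P ∷ premises
      ; collapses = collapse ∷ collapses
      ; variants  = renaming-variant (injective-∘ π-inj even-injective) C*∈ gP≈R ∷ variants
      ; vars-in-π = InImage-∘ vars-P ∷ All.map InImage-∘ vars-in-π
      ; apart     = All.map (disjoint-images π-inj vars-P) vars-in-π ∷ apart }
      where
      ρ = π ∘ even
      R = sC (rename ρ) C*
      σR≡ϑC* : sC σ R ≡ sC ϑ C*
      σR≡ϑC* = trans (substC-∘ C*) (substC-cong (λ y → trans (σπ≗ (even y)) (merge-even ϑ (chainSubst ws) y)) C*)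
      lifted = PremiseLifting.liftPremise σ j R (≈c-trans j≈ϑC* (≡⇒≈c (sym σR≡ϑC*)))
      P = proj₁ lifted
      gP≈R = proj₁ (proj₂ lifted)
      collapse = proj₂ (proj₂ lifted)
      vars-P : All (InImage (π ∘ even)) (varsC L T (gClause L T P))
      vars-P = All-varsC-⊆ₗ R (gClause L T P) (proj₁ gP≈R) (vars-renameC ρ C*)
      open LiftedChain (liftChain ls ws (π ∘ odd) (injective-∘ π-inj odd-injective)
                                  (λ y → trans (σπ≗ (odd y)) (merge-odd ϑ (chainSubst ws) y)))

  groups-unified : ∀ {σ Ps ls} → Pointwise (Collapses σ) Ps ls → Unifies L T σ (concatMap (groupEqs L T) Ps)
  groups-unified []       = []
  groups-unified (c ∷ cs) = AllP.++⁺ (Collapses.grouped c) (groups-unified cs)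

  links-unified : ∀ {σ P j Ps ls} → Collapses σ P j → Pointwise (Collapses σ) Ps ls → Chained L T j ls →
                  Unifies L T σ (linkEqs L T P Ps)
  links-unified c []         _               = []
  links-unified c (c′ ∷ cs) (right≡left , ch) =
    trans (Collapses.υ₀↦right c) (trans right≡left (sym (Collapses.ε₀↦left c′))) ∷ links-unified c′ cs ch

  last-collapses : ∀ {σ P j Ps ls} → Collapses σ P j → Pointwise (Collapses σ) Ps ls →
                   sE σ (GPrem.υ₀ (lastG L T P Ps)) ≡ Link.right (lastLink L T j ls)
  last-collapses c []        = Collapses.υ₀↦right c
  last-collapses c (c′ ∷ cs) = last-collapses c′ cs

  strict-premise : ∀ {σ Ps ls} → Pointwise (Collapses σ) Ps ls →
                   Any (λ j → Link.rel j ≡ ≺r) ls → Any (λ P → GPrem.rel P ≡ ≺r) Ps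
  strict-premise (c ∷ cs) (here strict) = here (trans (Collapses.rel≡ c) strict)
  strict-premise (c ∷ cs) (there s)     = there (strict-premise cs s)

  rests-collapse : ∀ {σ Ps ls} → Pointwise (Collapses σ) Ps ls →
                   sC σ (concatMap GPrem.rest Ps) ≈c concatMap Link.rest ls
  rests-collapse []                = ≈c-refl
  rests-collapse {σ} {P ∷ Ps} (c ∷ cs) =
    ≈c-trans (≡⇒≈c (ListP.map-++ (sL σ) (GPrem.rest P) (concatMap GPrem.rest Ps)))
             (≈c-++ (Collapses.rest↦rest c) (rests-collapse cs))

  endEq-unified : ∀ {σ P j Ps ls} → Collapses σ P j → Pointwise (Collapses σ) Ps ls →
                  (Link.right (lastLink L T j ls) ≡ tc c0 ⊎ Link.left j ≡ tc c1 ⊎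
                   Link.left j ≡ Link.right (lastLink L T j ls)) →
                  Σ (EndKind L T) (λ ek → Unifies L T σ (endEq L T ek P Ps ∷ []))
  endEq-unified c cs (inj₁ last≡0)        = last-zero  , trans (last-collapses c cs) last≡0 ∷ []
  endEq-unified c cs (inj₂ (inj₁ first≡1)) = first-one  , trans (Collapses.ε₀↦left c) first≡1 ∷ []
  endEq-unified c cs (inj₂ (inj₂ cycle))   =
    first-last , trans (Collapses.ε₀↦left c) (trans cycle (sym (last-collapses c cs))) ∷ []

  lift-b1 : ∀ {S Λ Cs Cs* C} → Lifts Cs Cs* → (k : LinkT) (ks : List LinkT) →
            All (λ j → Closed L T (linkClause j) × _∈C_ L T (linkClause j) Cs) (k ∷ ks) →
            IsContradiction L T k ks → C ≈c concatMap Link.rest (k ∷ ks) → LiftedStep S Λ Cs* C Λ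
  lift-b1 {S} {Λ} {Cs* = Cs*} {C} lifts k ks premises (chained , strict , ends) C≈ =
    resolve premises′ collapses variants apart
    where
    ws = All.map (instanceOfSome lifts ∘ proj₂) premises
    σ = chainSubst ws
    open ChainLifting σ Cs*
    open LiftedChain (liftChain (k ∷ ks) ws (λ x → x) (λ e → e) (λ _ → refl)) renaming (premises to premises′)
    resolve : ∀ Ps → Pointwise (Collapses σ) Ps (k ∷ ks) → All (λ P → InVrnt L T Cs* (gClause L T P)) Ps →
              AllPairs VarDisjoint Ps → LiftedStep S Λ Cs* C Λ
    resolve (P ∷ Ps) (c ∷ cs) vs ap =
      sC θ X , g1 P Ps ek θ vs ap (strict-premise (c ∷ cs) strict) θ-mgu ≈c-refl ,
      δ , ≈c-trans C≈ (≈c-trans (≈c-sym (rests-collapse (c ∷ cs)))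
                                (≡⇒≈c (sym (trans (substC-∘ X) (substC-cong (sym ∘ σ≗δθ) X)))))
      where
      X = concatMap GPrem.rest (P ∷ Ps)
      end = endEq-unified c cs ends
      ek = proj₁ end
      σ-unifies : Unifies L T σ (g1Eqs L T ek P Ps)
      σ-unifies = AllP.++⁺ (groups-unified (c ∷ cs)) (AllP.++⁺ (links-unified c cs chained) (proj₂ end))
      mgu = mgu-exists σ (g1Eqs L T ek P Ps) σ-unifies
      θ = proj₁ mgu
      θ-mgu = proj₂ mgu
      δ = proj₁ (proj₂ θ-mgu σ σ-unifies)
      σ≗δθ = proj₂ (proj₂ θ-mgu σ σ-unifies)

  liftStep : ∀ {S Λ Cs Cs* C Λ′} → Lifts Cs Cs* → BHStep L T S Λ Cs C Λ′ → LiftedStep S Λ Cs* C Λ′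
  liftStep {C = C} lifts (ordtc o)                 = C , ordtc o , var , ≡⇒≈c (sym (substC-id C))
  liftStep lifts (ginst D ϑ D∈S C≈ _ _)            = D , input D D∈S ≈c-refl , ϑ , C≈
  liftStep lifts (b1 k ks premises contra C≈)      = lift-b1 lifts k ks premises contra C≈
  liftStep lifts (b2-noQ a b noQ ia oa ib ob C≈)   = lift-b2-noQ lifts a b noQ ia oa ib ob C≈
  liftStep lifts (b2-Q a b hasQ ia oa ib ob nt C≈) = lift-b2-Q lifts a b hasQ ia oa ib ob nt C≈
  liftStep lifts (b3 q p as t qa-occ _ _ C≈)       = lift-b3 lifts q p as t qa-occ C≈
  liftStep lifts (b4 q p as b k oq ob w-new C≈)    = lift-b4 lifts q p as b k oq ob w-new C≈

  liftDeduction : ∀ {S Λ Cs} → BHDed L T S Λ Cs →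
                  Σ (List Cl) (λ Cs* → HDed L T S Λ Cs* × Lifts Cs Cs*)
  liftDeduction start = [] , start , []
  liftDeduction (step d st) with liftDeduction d
  ... | Cs* , d* , lifts with liftStep lifts st
  ...   | C* , st* , inst = C* ∷ Cs* , step d* st* , inst ∷ lifts

lemma1 : (L : Lang) (T : TCons) → HasConstant L →
         (S : ClauseSet L T) → OrderClausesOf L T S →
         (C : Clause L T) → cloBH L T S C →
         Σ (Clause L T) (λ C* → cloH L T S C* × InstanceOf L T C C*)
lemma1 L T _ S _ C (Λ , C′ , Cs , d , C≈C′) with Lifting.liftDeduction L T d
... | C* ∷ Cs* , d* , (ϑ , C′≈) ∷ _ =
  C* , (Λ , C* , Cs* , d* , Lifting.≈c-refl L T) , ϑ , Lifting.≈c-trans L T C≈C′ C′≈
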